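{- Every weak double cycle has at most one unit-free skew-symmetry.
   Context: A digraph has a finite vertex set and arcs $(a,b)$ with $a\ne b$, no parallel arcs. For $m\ge3$ a double $m$-cycle is a digraph isomorphic to the one with vertices $1,\dots,m$ and arcs $(i,i+1),(i+1,i)$ (indices mod $m$). Splitting a vertex $x$ replaces $x$ by new vertices $u,w$ with an arc $(u,w)$, arcs into $x$ now into $u$, arcs out of $x$ now out of $w$. Splitting an arc $(x,y)$ replaces it by $(x,w),(w,y)$ for a new vertex $w$. A weak double cycle (WDC) is a digraph obtained from some double $m$-cycle ($m\ge3$) by finitely many (possibly zero) vertex- and arc-splittings. A skew-symmetry of a digraph $G$ is a bijection $\sigma:V(G)\to V(G)$ with $\sigma(\sigma(v))=v$ and $\sigma(v)\ne v$ for all $v$, such that $(a,b)\in E(G)$ implies $(\sigma(b),\sigma(a))\in E(G)$. It is unit-free if $(v,\sigma(v))\notin E(G)$ for all $v\in V(G)$. -}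

module Defs where

open import Data.Nat using (ℕ; zero; suc; _≤_; _≡ᵇ_)
open import Data.Fin using (Fin; zero; suc; toℕ; _≟_)
open import Data.Bool using (Bool; true; false; _∧_; _∨_; not)
open import Data.Product using (Σ; _×_; _,_)
open import Relation.Nullary.Decidable using (⌊_⌋)
open import Relation.Binary.PropositionalEquality using (_≡_; _≢_)
open import Function.Bundles using (_↔_; Inverse)

-- A finite digraph: vertex set Fin size, arc relation given by a
-- Boolean adjacency function (so there are no parallel arcs).
record Digraph : Set where
  constructor digraph
  field
    size : ℕ
    Arc  : Fin size → Fin size → Bool

open Digraph public

-- The double m-cycle on vertices 0,…,m-1: arcs (i,i+1) and (i+1,i) mod m.
doubleCycle : ℕ → Digraph
doubleCycle m = digraph m adj
  where
  adj : Fin m → Fin m → Bool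
  adj i j = (toℕ j ≡ᵇ suc (toℕ i))
          ∨ (toℕ i ≡ᵇ suc (toℕ j))
          ∨ ((toℕ j ≡ᵇ 0) ∧ (suc (toℕ i) ≡ᵇ m))
          ∨ ((toℕ i ≡ᵇ 0) ∧ (suc (toℕ j) ≡ᵇ m))

-- Splitting vertex x: old vertex v becomes suc v (so x becomes u = suc x),
-- the new vertex w is zero. Arc (u,w); arcs into x go into u; arcs out of
-- x go out of w.
splitVertex : (G : Digraph) → Fin (size G) → Digraph
splitVertex G x = digraph (suc (size G)) adj
  where
  adj : Fin (suc (size G)) → Fin (suc (size G)) → Bool
  adj zero    zero    = false
  adj zero    (suc b) = Arc G x b
  adj (suc a) zero    = ⌊ a ≟ x ⌋
  adj (suc a) (suc b) = not ⌊ a ≟ x ⌋ ∧ Arc G a b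

-- Splitting arc (x,y): replace it by (x,w),(w,y), new vertex w = zero,
-- old vertex v becomes suc v.
splitArc : (G : Digraph) → Fin (size G) → Fin (size G) → Digraph
splitArc G x y = digraph (suc (size G)) adj
  where
  adj : Fin (suc (size G)) → Fin (suc (size G)) → Bool
  adj zero    zero    = false
  adj zero    (suc b) = ⌊ b ≟ y ⌋
  adj (suc a) zero    = ⌊ a ≟ x ⌋
  adj (suc a) (suc b) = Arc G a b ∧ not (⌊ a ≟ x ⌋ ∧ ⌊ b ≟ y ⌋)

data Splittable : Digraph → Set where
  double  : (m : ℕ) → 3 ≤ m → Splittable (doubleCycle m)
  vsplit  : {G : Digraph} → Splittable G → (x : Fin (size G)) →
            Splittable (splitVertex G x)
  asplit  : {G : Digraph} → Splittable G → (x y : Fin (size G)) →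
            Arc G x y ≡ true → Splittable (splitArc G x y)

record Iso (H G : Digraph) : Set where
  field
    bij      : Fin (size H) ↔ Fin (size G)
    preserve : ∀ a b → Arc H a b ≡ Arc G (Inverse.to bij a) (Inverse.to bij b)

WDC : Digraph → Set
WDC G = Σ Digraph (λ H → Splittable H × Iso H G)

record SkewSymmetry (G : Digraph) (σ : Fin (size G) → Fin (size G)) : Set where
  field
    involutive : ∀ v → σ (σ v) ≡ v
    noFixed    : ∀ v → σ v ≢ v
    skew       : ∀ a b → Arc G a b ≡ true → Arc G (σ b) (σ a) ≡ true

UnitFree : (G : Digraph) → (Fin (size G) → Fin (size G)) → Set
UnitFree G σ = ∀ v → Arc G v (σ v) ≡ false

UnitFreeSkewSymmetry : (G : Digraph) → (Fin (size G) → Fin (size G)) → Set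
UnitFreeSkewSymmetry G σ = SkewSymmetry G σ × UnitFree G σ

module Submission where

-- A weak double cycle is, up to isomorphism, a cyclic sequence of K ≥ 3
-- "hubs".  Hub j is a directed path  in(j) → … → out(j)  (the hub path, of
-- length h j ≥ 1); from out(j) a forward path (the F-segment of j) leads to
-- in(j+1), and from out(j+1) a backward path (the B-segment of j) leads to
-- in(j).  A digraph isomorphic to such a normal form is *realised* by it.
-- Part 1 shows that every weak double cycle is realised: double cycles are,
-- and splitting a vertex or an arc amounts to inserting one position into
-- a hub path or into a segment of the normal form.
--
-- In a
-- normal form the vertices with two in-neighbours are exactly the in(j),
-- those with two out-neighbours exactly the out(j), and all others lie on
-- a path with unique in- and out-neighbours.  Since σ reverses arcs, it
-- maps a maximal such path onto a maximal path read backwards, so σ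
-- induces an involution ρ on the hubs, reversing every hub path and
-- mapping F-segments onto B-segments.  Unit-freeness forbids a path being
-- mapped to itself reversed, which forces ρ to be the rotation
-- j ↦ j + K/2 (mod K).  Hence σ is given by an explicit formula depending
-- only on the normal form, and any two such σ coincide.

open import Defs
open import Data.Nat
open import Data.Nat.Properties
open import Data.Bool using (Bool; true; false; _∧_; _∨_)
open import Data.Bool.Properties using (T-≡)
open import Data.Product
open import Data.Sum
open import Data.Empty
open import Data.Fin using (Fin; zero; suc; toℕ; fromℕ<) renaming (_≟_ to _≟F_)
open import Data.Fin.Properties using (toℕ-injective; toℕ<n; toℕ-fromℕ<)
open import Function.Bundles using (Inverse; Equivalence)
open import Relation.Nullary
open import Relation.Nullary.Decidable using (⌊_⌋; _×-dec_)
open import Relation.Binary using (Tri; tri<; tri≈; tri>)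
open import Relation.Binary.PropositionalEquality

-- The cyclic order on {0, …, k-1}

next : ℕ → ℕ → ℕ
next k j with suc j <? k
... | yes _ = suc j
... | no _ = 0

prev : ℕ → ℕ → ℕ
prev k zero = pred k
prev k (suc j) = j

next-yes : ∀ {k j} → suc j < k → next k j ≡ suc j
next-yes {k} {j} p with suc j <? k
... | yes _ = refl
... | no q = ⊥-elim (q p)

next-no : ∀ {k j} → ¬ suc j < k → next k j ≡ 0
next-no {k} {j} p with suc j <? k
... | yes q = ⊥-elim (p q)
... | no _ = refl

next<k : ∀ {k} j → 0 < k → next k j < k
next<k {k} j 0<k with suc j <? k
... | yes p = p
... | no _ = 0<k

prev<k : ∀ {k} j → j < k → prev k j < k
prev<k {suc k} zero _ = n<1+n k
prev<k {k} (suc j) p = <-trans (n<1+n j) p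

next-prev : ∀ {k} j → j < k → next k (prev k j) ≡ j
next-prev {suc k} zero _ = next-no {suc k} {k} (n≮n (suc k))
next-prev {k} (suc j) p = next-yes p

prev-next : ∀ {k} j → j < k → prev k (next k j) ≡ j
prev-next {k} j p with suc j <? k
... | yes _ = refl
... | no q with k
...   | zero = ⊥-elim (n≮0 p)
...   | suc k' = suc-injective (≤-antisym (≮⇒≥ (λ z → q z)) p)

next²≢id : ∀ {k} j → 3 ≤ k → next k (next k j) ≢ j
next²≢id {k} j 3≤k e with suc j <? k
... | yes p with suc (suc j) <? k
...   | yes _ = <-irrefl (sym e) (<-trans (n<1+n j) (n<1+n (suc j)))
...   | no q = q (subst (λ z → suc (suc z) < k) e 3≤k)
next²≢id {k} j 3≤k e | no q with 1 <? k
... | yes _ = q (subst (λ z → suc z < k) e 3≤k)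
... | no r = r (≤-trans (s≤s (s≤s z≤n)) 3≤k)

lt-eq : ∀ {t n} → t < n → ¬ suc t < n → suc t ≡ n
lt-eq p q = ≤-antisym p (≮⇒≥ q)

rot : ℕ → ℕ → ℕ → ℕ
rot k c j with c + j <? k
... | yes _ = c + j
... | no _ = c + j ∸ k

rot-yes : ∀ {k c} j → c + j < k → rot k c j ≡ c + j
rot-yes {k} {c} j p with c + j <? k
... | yes _ = refl
... | no q = ⊥-elim (q p)

rot-no : ∀ {k c} j → ¬ c + j < k → rot k c j ≡ c + j ∸ k
rot-no {k} {c} j p with c + j <? k
... | yes q = ⊥-elim (p q)
... | no _ = refl

rot-next : ∀ {k c} j → c < k → suc j < k → next k (rot k c j) ≡ rot k c (suc j)
rot-next {k} {c} j ck sjk with c + j <? k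
... | yes p = go (suc (c + j) <? k)
  where
  e1 : c + suc j ≡ suc (c + j)
  e1 = +-suc c j
  go : Dec (suc (c + j) < k) → next k (c + j) ≡ rot k c (suc j)
  go (yes q) = trans (next-yes q) (sym (trans (rot-yes (suc j) (subst (_< k) (sym e1) q)) e1))
  go (no q) = trans (next-no q) (sym (trans (rot-no (suc j) (λ z → q (subst (_< k) e1 z)))
                (trans (cong (_∸ k) (trans e1 (lt-eq p q))) (n∸n≡0 k))))
... | no p = trans (next-yes lt) (sym (trans (rot-no (suc j) np') (trans (cong (_∸ k) (+-suc c j)) (+-∸-assoc 1 k≤c+j))))
  where
  k≤c+j : k ≤ c + j
  k≤c+j = ≮⇒≥ p
  np' : ¬ c + suc j < k
  np' z = p (<-trans (subst (c + j <_) (sym (+-suc c j)) (n<1+n _)) z)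
  lt : suc (c + j ∸ k) < k
  lt = subst (_< k) (trans (cong (_∸ k) (+-suc c j)) (+-∸-assoc 1 k≤c+j))
         (subst (c + suc j ∸ k <_) (m+n∸n≡m k k)
           (∸-monoˡ-< (+-mono-< ck sjk) (≤-trans k≤c+j (subst (c + j ≤_) (sym (+-suc c j)) (n≤1+n _)))))

double-inj : ∀ a b → a + a ≡ b + b → a ≡ b
double-inj a b e with <-cmp a b
... | tri≈ _ q _ = q
... | tri< lt _ _ = ⊥-elim (<-irrefl e (+-mono-< lt lt))
... | tri> _ _ gt = ⊥-elim (<-irrefl (sym e) (+-mono-< gt gt))

-- Normal forms of weak double cycles

-- The three kinds of path attached to hub j: its hub path H, its forward
-- segment F (from out(j) to in(next j)) and its backward segment B (from
-- out(next j) to in(j)).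
data Seg : Set where
  H F B : Seg

record Model : Set where
  constructor model
  field
    k : ℕ
    h f b : ℕ → ℕ
open Model public

len : Model → Seg → ℕ → ℕ
len M H = h M
len M F = f M
len M B = b M

-- Position t on the path of kind s attached to hub j.
data Pos : Set where
  pos : ℕ → Seg → ℕ → Pos

Valid : Model → Pos → Set
Valid M (pos j s t) = j < k M × t < len M s j

segExit : Model → Seg → ℕ → Pos
segExit M F j = pos (next (k M) j) H 0
segExit M B j = pos j H 0
segExit M H j = pos j H 0

onSeg : Model → Seg → ℕ → ℕ → Pos
onSeg M s j u with u <? len M s j
... | yes _ = pos j s u
... | no _ = segExit M s j

-- Leaving a path: out(j) continues forward (true) into the F-segment of j
-- or backward (false) into the B-segment of prev j.
exit : Model → Bool → Seg → ℕ → Pos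
exit M i     F j = segExit M F j
exit M i     B j = segExit M B j
exit M true  H j = onSeg M F j 0
exit M false H j = onSeg M B (prev (k M) j) 0

advance : Model → Bool → Seg → ℕ → ℕ → Pos
advance M i s j u with u <? len M s j
... | yes _ = pos j s u
... | no _ = exit M i s j

succ : Model → Bool → Pos → Pos
succ M i (pos j s t) = advance M i s j (suc t)

MArc : Model → Pos → Pos → Set
MArc M p q = q ≡ succ M true p ⊎ q ≡ succ M false p

onSeg-yes : ∀ M s j u → u < len M s j → onSeg M s j u ≡ pos j s u
onSeg-yes M s j u p with u <? len M s j
... | yes _ = refl
... | no q = ⊥-elim (q p)

onSeg-no : ∀ M s j u → ¬ u < len M s j → onSeg M s j u ≡ segExit M s j
onSeg-no M s j u p with u <? len M s j
... | yes q = ⊥-elim (p q)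
... | no _ = refl

advance-yes : ∀ M i s j u → u < len M s j → advance M i s j u ≡ pos j s u
advance-yes M i s j u p with u <? len M s j
... | yes _ = refl
... | no q = ⊥-elim (q p)

advance-no : ∀ M i s j u → ¬ u < len M s j → advance M i s j u ≡ exit M i s j
advance-no M i s j u p with u <? len M s j
... | yes q = ⊥-elim (p q)
... | no _ = refl

record WF (M : Model) : Set where
  field
    k≥3 : 3 ≤ k M
    h>0 : ∀ j → 0 < h M j
open WF public

outP : Model → ℕ → Pos
outP M j = pos j H (pred (h M j))

jOf : Pos → ℕ
jOf (pos j s t) = j

inP : ℕ → Pos
inP j = pos j H 0

IsIn : Pos → Set
IsIn (pos j s t) = s ≡ H × t ≡ 0

IsOut : Model → Pos → Set
IsOut M (pos j s t) = s ≡ H × suc t ≡ h M j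

-- The predecessor of a position that is not an in-vertex.
predPos : Model → Pos → Pos
predPos M (pos j s (suc t)) = pos j s t
predPos M (pos j H zero) = pos j H zero
predPos M (pos j F zero) = outP M j
predPos M (pos j B zero) = outP M (next (k M) j)

posF : Model → ℕ → ℕ → Pos
posF M j zero = outP M j
posF M j (suc i) = onSeg M F j i

posB : Model → ℕ → ℕ → Pos
posB M j zero = outP M (next (k M) j)
posB M j (suc i) = onSeg M B j i

F≢B : F ≢ B
F≢B ()
F≢H : F ≢ H
F≢H ()
H≢B : H ≢ B
H≢B ()

pos-injˢ : ∀ {j j' s s' t t'} → pos j s t ≡ pos j' s' t' → s ≡ s'
pos-injˢ refl = refl
pos-injʲ : ∀ {j j' s s' t t'} → pos j s t ≡ pos j' s' t' → j ≡ j'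
pos-injʲ refl = refl
pos-injᵗ : ∀ {j j' s s' t t'} → pos j s t ≡ pos j' s' t' → t ≡ t'
pos-injᵗ refl = refl

sucpred : ∀ n → 0 < n → suc (pred n) ≡ n
sucpred (suc n) _ = refl

pred< : ∀ n → 0 < n → pred n < n
pred< (suc n) _ = n<1+n n

advance-FB : ∀ M i s j u → s ≢ H → advance M i s j u ≡ onSeg M s j u
advance-FB M i H j u ne = ⊥-elim (ne refl)
advance-FB M i F j u ne with u <? f M j
... | yes _ = refl
... | no _ = refl
advance-FB M i B j u ne with u <? b M j
... | yes _ = refl
... | no _ = refl

module _ (M : Model) (wf : WF M) where
  private
    K = k M
    0<k : 0 < K
    0<k = ≤-trans (s≤s z≤n) (k≥3 wf)

  next≢prev : ∀ j → j < K → next K j ≢ prev K j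
  next≢prev j p e = next²≢id {K} j (k≥3 wf) (trans (cong (next K) e) (next-prev j p))

  outP-valid : ∀ j → j < K → Valid M (outP M j)
  outP-valid j p = p , pred< (h M j) (h>0 wf j)

  inP-valid : ∀ j → j < K → Valid M (inP j)
  inP-valid j p = p , h>0 wf j

  succ-out-T : ∀ j → succ M true (outP M j) ≡ onSeg M F j 0
  succ-out-T j = trans (cong (advance M true H j) (sucpred _ (h>0 wf j)))
                     (advance-no M true H j (h M j) (n≮n _))

  succ-out-F : ∀ j → succ M false (outP M j) ≡ onSeg M B (prev K j) 0
  succ-out-F j = trans (cong (advance M false H j) (sucpred _ (h>0 wf j)))
                     (advance-no M false H j (h M j) (n≮n _))

  succ-hub : ∀ i j t → suc t < h M j → succ M i (pos j H t) ≡ pos j H (suc t)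
  succ-hub i j t p = advance-yes M i H j (suc t) p

  succ-F : ∀ i j t → succ M i (pos j F t) ≡ onSeg M F j (suc t)
  succ-F i j t = advance-FB M i F j (suc t) (λ ())

  succ-B : ∀ i j t → succ M i (pos j B t) ≡ onSeg M B j (suc t)
  succ-B i j t = advance-FB M i B j (suc t) (λ ())

  onSeg-valid : ∀ s j u → s ≢ H → j < K → Valid M (onSeg M s j u)
  onSeg-valid H j u ne _ = ⊥-elim (ne refl)
  onSeg-valid F j u ne p with u <? f M j
  ... | yes q = p , q
  ... | no _ = next<k j 0<k , h>0 wf _
  onSeg-valid B j u ne p with u <? b M j
  ... | yes q = p , q
  ... | no _ = p , h>0 wf _

  exit-valid : ∀ i s j → j < K → Valid M (exit M i s j)
  exit-valid true H j jk = onSeg-valid F j 0 (λ ()) jk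
  exit-valid false H j jk = onSeg-valid B (prev K j) 0 (λ ()) (prev<k j jk)
  exit-valid i F j jk = next<k j 0<k , h>0 wf _
  exit-valid i B j jk = jk , h>0 wf _

  succ-valid : ∀ i p → Valid M p → Valid M (succ M i p)
  succ-valid i (pos j s t) (jk , tl) = go (suc t <? len M s j)
    where
    go : Dec (suc t < len M s j) → Valid M (advance M i s j (suc t))
    go (yes q) = subst (Valid M) (sym (advance-yes M i s j (suc t) q)) (jk , q)
    go (no q) = subst (Valid M) (sym (advance-no M i s j (suc t) q)) (exit-valid i s j jk)

  exit-eq : ∀ s j t → t < len M s j → ¬ suc t < len M s j → ¬ IsOut M (pos j s t) → exit M true s j ≡ exit M false s j
  exit-eq H j t a b c = ⊥-elim (c (refl , lt-eq a b))
  exit-eq F j t _ _ _ = refl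
  exit-eq B j t _ _ _ = refl

  succ-nonout : ∀ p → Valid M p → ¬ IsOut M p → succ M true p ≡ succ M false p
  succ-nonout (pos j s t) (jk , tl) nout = go (suc t <? len M s j)
    where
    go : Dec (suc t < len M s j) → advance M true s j (suc t) ≡ advance M false s j (suc t)
    go (yes q) = trans (advance-yes M true s j (suc t) q) (sym (advance-yes M false s j (suc t) q))
    go (no q) = trans (advance-no M true s j (suc t) q) (trans (exit-eq s j t tl q nout) (sym (advance-no M false s j (suc t) q)))

  succ-out-distinct : ∀ j → j < K → succ M true (outP M j) ≢ succ M false (outP M j)
  succ-out-distinct j jk e = go (0 <? f M j) (0 <? b M (prev K j)) (trans (sym (succ-out-T j)) (trans e (succ-out-F j)))
    where
    go : Dec (0 < f M j) → Dec (0 < b M (prev K j)) → onSeg M F j 0 ≡ onSeg M B (prev K j) 0 → ⊥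
    go (yes p) (yes q) e = F≢B (pos-injˢ (trans (sym (onSeg-yes M F j 0 p)) (trans e (onSeg-yes M B (prev K j) 0 q))))
    go (yes p) (no q) e = F≢H (pos-injˢ (trans (sym (onSeg-yes M F j 0 p)) (trans e (onSeg-no M B (prev K j) 0 q))))
    go (no p) (yes q) e = H≢B (pos-injˢ (trans (sym (onSeg-no M F j 0 p)) (trans e (onSeg-yes M B (prev K j) 0 q))))
    go (no p) (no q) e = next≢prev j jk (pos-injʲ (trans (sym (onSeg-no M F j 0 p)) (trans e (onSeg-no M B (prev K j) 0 q))))

  outP-isOut : ∀ j → IsOut M (outP M j)
  outP-isOut j = refl , sucpred _ (h>0 wf j)

  isOut-outP : ∀ j s t → IsOut M (pos j s t) → pos j s t ≡ outP M j
  isOut-outP j .H t (refl , e) = cong (pos j H) (cong pred e)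

  exit-pred : ∀ i s j t → j < K → suc t ≡ len M s j → ¬ IsIn (exit M i s j) → pos j s t ≡ predPos M (exit M i s j)
  exit-pred i F j t jk e ni = ⊥-elim (ni (refl , refl))
  exit-pred i B j t jk e ni = ⊥-elim (ni (refl , refl))
  exit-pred true H j t jk e ni = go (0 <? f M j)
    where
    go : Dec (0 < f M j) → pos j H t ≡ predPos M (onSeg M F j 0)
    go (yes p) rewrite onSeg-yes M F j 0 p = cong (pos j H) (cong pred e)
    go (no p) rewrite onSeg-no M F j 0 p = ⊥-elim (ni (refl , refl))
  exit-pred false H j t jk e ni = go (0 <? b M (prev K j))
    where
    go : Dec (0 < b M (prev K j)) → pos j H t ≡ predPos M (onSeg M B (prev K j) 0)
    go (yes p) rewrite onSeg-yes M B (prev K j) 0 p | next-prev {K} j jk = cong (pos j H) (cong pred e)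
    go (no p) rewrite onSeg-no M B (prev K j) 0 p = ⊥-elim (ni (refl , refl))

  succ-pred : ∀ i p → Valid M p → ¬ IsIn (succ M i p) → p ≡ predPos M (succ M i p)
  succ-pred i (pos j s t) (jk , tl) ni = go (suc t <? len M s j) ni
    where
    go : (d : Dec (suc t < len M s j)) → ¬ IsIn (advance M i s j (suc t)) → pos j s t ≡ predPos M (advance M i s j (suc t))
    go (yes q) ni' rewrite advance-yes M i s j (suc t) q = refl
    go (no q) ni' rewrite advance-no M i s j (suc t) q = exit-pred i s j t jk (lt-eq tl q) ni'

  pred-unique : ∀ p q → Valid M p → MArc M p q → ¬ IsIn q → p ≡ predPos M q
  pred-unique p q vp (inj₁ refl) ni = succ-pred true p vp ni
  pred-unique p q vp (inj₂ refl) ni = succ-pred false p vp ni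

  pred-arc : ∀ q → Valid M q → ¬ IsIn q → Valid M (predPos M q) × MArc M (predPos M q) q
  pred-arc (pos j s (suc t)) (jk , tl) ni =
    (jk , <-trans (n<1+n t) tl) , inj₁ (sym (advance-yes M true s j (suc t) tl))
  pred-arc (pos j H zero) (jk , tl) ni = ⊥-elim (ni (refl , refl))
  pred-arc (pos j F zero) (jk , tl) ni =
    outP-valid j jk , inj₁ (sym (trans (succ-out-T j) (onSeg-yes M F j 0 tl)))
  pred-arc (pos j B zero) (jk , tl) ni =
    outP-valid (next K j) (next<k j 0<k) ,
    inj₂ (sym (trans (succ-out-F (next K j)) (trans (cong (λ z → onSeg M B z 0) (prev-next j jk)) (onSeg-yes M B j 0 tl))))

  TwoPred : Pos → Set
  TwoPred q = Σ Pos λ p1 → Σ Pos λ p2 → Valid M p1 × Valid M p2 × p1 ≢ p2 × MArc M p1 q × MArc M p2 q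

  -- An in-vertex has two distinct in-neighbours: the ends of the F-segment
  -- of prev j and of the B-segment of j.
  two-in : ∀ j → j < K → TwoPred (inP j)
  two-in j jk = go (0 <? f M (prev K j)) (0 <? b M j)
    where
    pj = prev K j
    pjk : pj < K
    pjk = prev<k j jk
    a1 : ¬ 0 < f M pj → MArc M (outP M pj) (inP j)
    a1 p = inj₁ (sym (trans (succ-out-T pj) (trans (onSeg-no M F pj 0 p) (cong (λ z → pos z H 0) (next-prev j jk)))))
    a1' : (p : 0 < f M pj) → MArc M (pos pj F (pred (f M pj))) (inP j)
    a1' p = inj₁ (sym (trans (succ-F true pj (pred (f M pj)))
                    (trans (cong (onSeg M F pj) (sucpred _ p))
                    (trans (onSeg-no M F pj (f M pj) (n≮n _)) (cong (λ z → pos z H 0) (next-prev j jk))))))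
    a2 : ¬ 0 < b M j → MArc M (outP M (next K j)) (inP j)
    a2 p = inj₂ (sym (trans (succ-out-F (next K j)) (trans (cong (λ z → onSeg M B z 0) (prev-next j jk)) (onSeg-no M B j 0 p))))
    a2' : (p : 0 < b M j) → MArc M (pos j B (pred (b M j))) (inP j)
    a2' p = inj₁ (sym (trans (succ-B true j (pred (b M j)))
                    (trans (cong (onSeg M B j) (sucpred _ p)) (onSeg-no M B j (b M j) (n≮n _)))))
    go : Dec (0 < f M pj) → Dec (0 < b M j) → TwoPred (inP j)
    go (yes p) (yes q) = pos pj F (pred (f M pj)) , pos j B (pred (b M j)) , (pjk , pred< _ p) , (jk , pred< _ q) , (λ e → F≢B (pos-injˢ e)) , a1' p , a2' q
    go (yes p) (no q) = pos pj F (pred (f M pj)) , outP M (next K j) , (pjk , pred< _ p) , outP-valid (next K j) (next<k j 0<k) , (λ e → F≢H (pos-injˢ e)) , a1' p , a2 q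
    go (no p) (yes q) = outP M pj , pos j B (pred (b M j)) , outP-valid pj pjk , (jk , pred< _ q) , (λ e → H≢B (pos-injˢ e)) , a1 p , a2' q
    go (no p) (no q) = outP M pj , outP M (next K j) , outP-valid pj pjk , outP-valid (next K j) (next<k j 0<k) ,
                       (λ e → next≢prev j jk (sym (pos-injʲ e))) , a1 p , a2 q

-- Inserting one position into a path of a normal form.  This is how
-- vertex and arc splittings act on normal forms.

_≟S_ : (s s' : Seg) → Dec (s ≡ s')
H ≟S H = yes refl
H ≟S F = no (λ ())
H ≟S B = no (λ ())
F ≟S H = no (λ ())
F ≟S F = yes refl
F ≟S B = no (λ ())
B ≟S H = no (λ ())
B ≟S F = no (λ ())
B ≟S B = yes refl

upd : (ℕ → ℕ) → ℕ → ℕ → ℕ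
upd g j0 j with j ≟ j0
... | yes _ = suc (g j)
... | no _ = g j

upd-eq : ∀ g j0 → upd g j0 j0 ≡ suc (g j0)
upd-eq g j0 with j0 ≟ j0
... | yes _ = refl
... | no q = ⊥-elim (q refl)

upd-ne : ∀ g j0 j → j ≢ j0 → upd g j0 j ≡ g j
upd-ne g j0 j ne with j ≟ j0
... | yes q = ⊥-elim (ne q)
... | no _ = refl

updIf : {A : Set} → Dec A → (ℕ → ℕ) → ℕ → (ℕ → ℕ)
updIf (yes _) g j0 = upd g j0
updIf (no _) g j0 = g

ins : Model → Seg → ℕ → Model
ins M s0 j0 = model (k M) (updIf (H ≟S s0) (h M) j0) (updIf (F ≟S s0) (f M) j0) (updIf (B ≟S s0) (b M) j0)

len-ins-eq : ∀ M s0 j0 → len (ins M s0 j0) s0 j0 ≡ suc (len M s0 j0)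
len-ins-eq M H j0 = upd-eq (h M) j0
len-ins-eq M F j0 = upd-eq (f M) j0
len-ins-eq M B j0 = upd-eq (b M) j0

len-ins-ne : ∀ M s0 j0 s j → ¬ (s ≡ s0 × j ≡ j0) → len (ins M s0 j0) s j ≡ len M s j
len-ins-ne M H j0 H j ne = upd-ne (h M) j0 j (λ e → ne (refl , e))
len-ins-ne M H j0 F j ne = refl
len-ins-ne M H j0 B j ne = refl
len-ins-ne M F j0 H j ne = refl
len-ins-ne M F j0 F j ne = upd-ne (f M) j0 j (λ e → ne (refl , e))
len-ins-ne M F j0 B j ne = refl
len-ins-ne M B j0 H j ne = refl
len-ins-ne M B j0 F j ne = refl
len-ins-ne M B j0 B j ne = upd-ne (b M) j0 j (λ e → ne (refl , e))

len-ins-≥ : ∀ M s0 j0 s j → len M s j ≤ len (ins M s0 j0) s j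
len-ins-≥ M s0 j0 s j with (s ≟S s0) ×-dec (j ≟ j0)
... | yes (refl , refl) = ≤-trans (n≤1+n _) (≤-reflexive (sym (len-ins-eq M s0 j0)))
... | no ne = ≤-reflexive (sym (len-ins-ne M s0 j0 s j ne))

-- shift s0 j0 t0 renames the old positions when a new position is
-- inserted at index t0 of path s0 of hub j0: later positions move up.
shiftAux : ∀ {A B C : Set} → Dec A → Dec B → Dec C → ℕ → Seg → ℕ → Pos
shiftAux (yes _) (yes _) (yes _) j s t = pos j s (suc t)
shiftAux _ _ _ j s t = pos j s t

shift : Seg → ℕ → ℕ → Pos → Pos
shift s0 j0 t0 (pos j s t) = shiftAux (s ≟S s0) (j ≟ j0) (t0 ≤? t) j s t

shift-ge : ∀ s0 j0 t0 t → t0 ≤ t → shift s0 j0 t0 (pos j0 s0 t) ≡ pos j0 s0 (suc t)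
shift-ge s0 j0 t0 t le with s0 ≟S s0 | j0 ≟ j0 | t0 ≤? t
... | yes _ | yes _ | yes _ = refl
... | no q | _ | _ = ⊥-elim (q refl)
... | yes _ | no q | _ = ⊥-elim (q refl)
... | yes _ | yes _ | no q = ⊥-elim (q le)

shift-lt : ∀ s0 j0 t0 t → t < t0 → shift s0 j0 t0 (pos j0 s0 t) ≡ pos j0 s0 t
shift-lt s0 j0 t0 t lt with s0 ≟S s0 | j0 ≟ j0 | t0 ≤? t
... | yes _ | yes _ | yes q = ⊥-elim (<⇒≱ lt q)
... | no _ | _ | _ = refl
... | yes _ | no _ | _ = refl
... | yes _ | yes _ | no _ = refl

shift-ne : ∀ s0 j0 t0 j s t → ¬ (s ≡ s0 × j ≡ j0) → shift s0 j0 t0 (pos j s t) ≡ pos j s t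
shift-ne s0 j0 t0 j s t ne with s ≟S s0 | j ≟ j0 | t0 ≤? t
... | yes a | yes c | yes _ = ⊥-elim (ne (a , c))
... | no _ | _ | _ = refl
... | yes _ | no _ | _ = refl
... | yes _ | yes _ | no _ = refl

shift-view : ∀ s0 j0 t0 j s t →
  (s ≡ s0 × j ≡ j0 × t0 ≤ t × shift s0 j0 t0 (pos j s t) ≡ pos j s (suc t)) ⊎
  (¬ (s ≡ s0 × j ≡ j0 × t0 ≤ t) × shift s0 j0 t0 (pos j s t) ≡ pos j s t)
shift-view s0 j0 t0 j s t with s ≟S s0 | j ≟ j0 | t0 ≤? t
... | yes a | yes c | yes d = inj₁ (a , c , d , refl)
... | no a | _ | _ = inj₂ ((λ z → a (proj₁ z)) , refl)
... | yes _ | no c | _ = inj₂ ((λ z → c (proj₁ (proj₂ z))) , refl)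
... | yes _ | yes _ | no d = inj₂ ((λ z → d (proj₂ (proj₂ z))) , refl)

shift-inj : ∀ s0 j0 t0 p q → shift s0 j0 t0 p ≡ shift s0 j0 t0 q → p ≡ q
shift-inj s0 j0 t0 (pos j s t) (pos j' s' t') e
  with shift-view s0 j0 t0 j s t | shift-view s0 j0 t0 j' s' t'
... | inj₁ (_ , _ , _ , e1) | inj₁ (_ , _ , _ , e2) =
  cong-pos (pos-injʲ e') (pos-injˢ e') (suc-injective (pos-injᵗ e'))
  where e' = trans (sym e1) (trans e e2)
        cong-pos : ∀ {a a' c c' d d'} → a ≡ a' → c ≡ c' → d ≡ d' → pos a c d ≡ pos a' c' d'
        cong-pos refl refl refl = refl
... | inj₂ (_ , e1) | inj₂ (_ , e2) = trans (sym e1) (trans e e2)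
... | inj₁ (refl , refl , le , e1) | inj₂ (n2 , e2) =
  ⊥-elim (n2 (sym (pos-injˢ e') , sym (pos-injʲ e') , ≤-trans le (≤-trans (n≤1+n _) (≤-reflexive (pos-injᵗ e')))))
  where e' = trans (sym e1) (trans e e2)
... | inj₂ (n1 , e1) | inj₁ (refl , refl , le , e2) =
  ⊥-elim (n1 (pos-injˢ e' , pos-injʲ e' , ≤-trans le (≤-trans (n≤1+n _) (≤-reflexive (sym (pos-injᵗ e'))))))
  where e' = trans (sym e1) (trans e e2)

new≢shift : ∀ s0 j0 t0 p → pos j0 s0 t0 ≢ shift s0 j0 t0 p
new≢shift s0 j0 t0 (pos j s t) e with shift-view s0 j0 t0 j s t
... | inj₁ (_ , _ , le , e1) = <-irrefl (pos-injᵗ (trans e e1)) (s≤s le)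
... | inj₂ (n1 , e1) = n1 (sym (pos-injˢ e') , sym (pos-injʲ e') , ≤-reflexive (pos-injᵗ e'))
  where e' = trans e e1

-- The effect of an insertion on the successor function: it commutes with
-- the renaming shift, except at the (at most two) arcs that the new
-- position interrupts, the "redirected" arcs described by Red.
module InsLemmas (M : Model) (wf : WF M) (s0 : Seg) (j0 t0 : ℕ)
                 (j0k : j0 < k M) (t0l : t0 ≤ len M s0 j0) (hpos : s0 ≡ H → 0 < t0) where
  M' : Model
  M' = ins M s0 j0
  sh : Pos → Pos
  sh = shift s0 j0 t0
  new : Pos
  new = pos j0 s0 t0
  K : ℕ
  K = k M

  wf' : WF M'
  wf' = record { k≥3 = k≥3 wf ; h>0 = λ j → ≤-trans (h>0 wf j) (len-ins-≥ M s0 j0 H j) }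

  len'≡ : len M' s0 j0 ≡ suc (len M s0 j0)
  len'≡ = len-ins-eq M s0 j0

  lt-len' : ∀ {u} → u ≤ len M s0 j0 → u < len M' s0 j0
  lt-len' le = subst (λ z → _ < z) (sym len'≡) (s≤s le)

  valid-new : Valid M' new
  valid-new = j0k , lt-len' t0l

  valid-sh : ∀ p → Valid M p → Valid M' (sh p)
  valid-sh (pos j s t) (jk , tl) with shift-view s0 j0 t0 j s t
  ... | inj₁ (refl , refl , _ , e) rewrite e = jk , lt-len' tl
  ... | inj₂ (_ , e) rewrite e = jk , <-≤-trans tl (len-ins-≥ M s0 j0 s j)

  sh-H0 : ∀ j → sh (pos j H 0) ≡ pos j H 0
  sh-H0 j with shift-view s0 j0 t0 j H 0
  ... | inj₁ (e , _ , le , _) = ⊥-elim (<-irrefl refl (≤-trans (hpos (sym e)) le))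
  ... | inj₂ (_ , e) = e

  shift-surj : ∀ q → Valid M' q → q ≡ new ⊎ Σ Pos (λ p → Valid M p × sh p ≡ q)
  shift-surj (pos j s t) (jk , tl) with (s ≟S s0) ×-dec (j ≟ j0)
  ... | yes (refl , refl) = go (<-cmp t t0)
    where
    go : Tri (t < t0) (t ≡ t0) (t0 < t) → pos j0 s0 t ≡ new ⊎ Σ Pos (λ p → Valid M p × sh p ≡ pos j0 s0 t)
    go (tri< a _ _) = inj₂ (pos j0 s0 t , (jk , <-≤-trans a t0l) , shift-lt s0 j0 t0 t a)
    go (tri≈ _ e _) = inj₁ (cong (pos j0 s0) e)
    go (tri> _ _ (s≤s {n = t'} c)) = inj₂ (pos j0 s0 t' , (jk , ≤-pred (subst (λ z → _ < z) len'≡ tl)) , shift-ge s0 j0 t0 t' c)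
  ... | no ne = inj₂ (pos j s t , (jk , subst (λ z → _ < z) (len-ins-ne M s0 j0 s j ne) tl) , shift-ne s0 j0 t0 j s t ne)

  onSeg-shift : ∀ s j → j < K → ¬ (s ≡ s0 × j ≡ j0 × t0 ≡ 0) → onSeg M' s j 0 ≡ sh (onSeg M s j 0)
  onSeg-shift s j jk nex with (s ≟S s0) ×-dec (j ≟ j0)
  ... | yes (refl , refl) = go t0 refl
    where
    go : ∀ t → t ≡ t0 → onSeg M' s0 j0 0 ≡ sh (onSeg M s0 j0 0)
    go zero e = ⊥-elim (nex (refl , refl , sym e))
    go (suc t) e rewrite onSeg-yes M' s0 j0 0 (lt-len' z≤n)
                       | onSeg-yes M s0 j0 0 (≤-trans (s≤s z≤n) (subst (_≤ len M s0 j0) (sym e) t0l))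
                       = sym (shift-lt s0 j0 t0 0 (subst (0 <_) e (s≤s z≤n)))
  ... | no ne = go (0 <? len M s j)
    where
    ls = len-ins-ne M s0 j0 s j ne
    segExit-shift : ∀ s → segExit M' s j ≡ sh (segExit M s j)
    segExit-shift H = sym (sh-H0 j)
    segExit-shift F = sym (sh-H0 _)
    segExit-shift B = sym (sh-H0 j)
    go : Dec (0 < len M s j) → onSeg M' s j 0 ≡ sh (onSeg M s j 0)
    go (yes p) rewrite onSeg-yes M' s j 0 (subst (0 <_) (sym ls) p) | onSeg-yes M s j 0 p = sym (shift-ne s0 j0 t0 j s 0 ne)
    go (no p) rewrite onSeg-no M' s j 0 (subst (λ z → ¬ 0 < z) (sym ls) p) | onSeg-no M s j 0 p = segExit-shift s

  -- Leaving hub j in direction i enters the new position directly.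
  Exc : Bool → ℕ → Set
  Exc i j = t0 ≡ 0 × ((i ≡ true × s0 ≡ F × j ≡ j0) ⊎ (i ≡ false × s0 ≡ B × prev K j ≡ j0))

  exit-shift : ∀ i s j → j < K → (s ≡ H → ¬ Exc i j) → exit M' i s j ≡ sh (exit M i s j)
  exit-shift i F j jk nex = sym (sh-H0 _)
  exit-shift i B j jk nex = sym (sh-H0 j)
  exit-shift true H j jk nex = onSeg-shift F j jk (λ { (e1 , e2 , e3) → nex refl (e3 , inj₁ (refl , sym e1 , e2)) })
  exit-shift false H j jk nex = onSeg-shift B (prev K j) (prev<k j jk) (λ { (e1 , e2 , e3) → nex refl (e3 , inj₂ (refl , sym e1 , e2)) })

  -- The old arcs (p, succ M i p) that now lead into the new position: the
  -- arc into old index t0 of the extended path, or, if t0 = 0 on a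
  -- segment, the arc leaving the out-vertex that starts this segment.
  Red : Bool → Pos → Set
  Red i p = (Σ ℕ λ t' → t0 ≡ suc t' × p ≡ pos j0 s0 t') ⊎
            (t0 ≡ 0 × ((i ≡ true × s0 ≡ F × p ≡ outP M j0) ⊎ (i ≡ false × s0 ≡ B × p ≡ outP M (next K j0))))

  noExcH : ∀ i → s0 ≡ H → ¬ Exc i j0
  noExcH i e (t0z , _) = <-irrefl (sym t0z) (hpos e)

  succ-shift-same : ∀ i t → t < len M s0 j0 → ¬ Red i (pos j0 s0 t) →
                    succ M' i (sh (pos j0 s0 t)) ≡ sh (succ M i (pos j0 s0 t))
  succ-shift-same i t tl nr = same (t0 ≤? t)
    where
    same : Dec (t0 ≤ t) → succ M' i (sh (pos j0 s0 t)) ≡ sh (advance M i s0 j0 (suc t))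
    same (no lt) rewrite shift-lt s0 j0 t0 t (≰⇒> lt) = go (m≤n⇒m<n∨m≡n (≰⇒> lt))
      where
      go : suc t < t0 ⊎ suc t ≡ t0 → advance M' i s0 j0 (suc t) ≡ sh (advance M i s0 j0 (suc t))
      go (inj₁ a) rewrite advance-yes M' i s0 j0 (suc t) (lt-len' (≤-trans (<⇒≤ a) t0l))
                        | advance-yes M i s0 j0 (suc t) (<-≤-trans a t0l) = sym (shift-lt s0 j0 t0 (suc t) a)
      go (inj₂ e) = ⊥-elim (nr (inj₁ (t , sym e , refl)))
    same (yes le) rewrite shift-ge s0 j0 t0 t le = go (suc t <? len M s0 j0)
      where
      go : Dec (suc t < len M s0 j0) → advance M' i s0 j0 (suc (suc t)) ≡ sh (advance M i s0 j0 (suc t))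
      go (yes a) rewrite advance-yes M' i s0 j0 (suc (suc t)) (lt-len' a)
                       | advance-yes M i s0 j0 (suc t) a = sym (shift-ge s0 j0 t0 (suc t) (≤-trans le (n≤1+n t)))
      go (no a) rewrite advance-no M' i s0 j0 (suc (suc t)) (λ z → a (≤-pred (subst (λ w → _ < w) len'≡ z)))
                      | advance-no M i s0 j0 (suc t) a = exit-shift i s0 j0 j0k (λ e → noExcH i e)

  succ-shift-other : ∀ i j s t → j < K → t < len M s j → ¬ (s ≡ s0 × j ≡ j0) → ¬ Red i (pos j s t) →
                     succ M' i (sh (pos j s t)) ≡ sh (succ M i (pos j s t))
  succ-shift-other i j s t jk tl ne nr rewrite shift-ne s0 j0 t0 j s t ne = go (suc t <? len M s j)
    where
    ls = len-ins-ne M s0 j0 s j ne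
    nex : s ≡ H → suc t ≡ len M s j → ¬ Exc i j
    nex refl e (t0z , inj₁ (refl , refl , refl)) =
      nr (inj₂ (t0z , inj₁ (refl , refl , cong (pos j H) (cong pred e))))
    nex refl e (t0z , inj₂ (refl , refl , refl)) =
      nr (inj₂ (t0z , inj₂ (refl , refl ,
        cong₂ (λ u v → pos u H v) (sym (next-prev j jk)) (cong pred (trans e (cong (h M) (sym (next-prev j jk))))))))
    go : Dec (suc t < len M s j) → advance M' i s j (suc t) ≡ sh (advance M i s j (suc t))
    go (yes a) rewrite advance-yes M' i s j (suc t) (subst (λ w → _ < w) (sym ls) a)
                     | advance-yes M i s j (suc t) a = sym (shift-ne s0 j0 t0 j s (suc t) ne)
    go (no a) rewrite advance-no M' i s j (suc t) (subst (λ w → ¬ _ < w) (sym ls) a)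
                    | advance-no M i s j (suc t) a = exit-shift i s j jk (λ e → nex e (lt-eq tl a))

  succ-shift : ∀ i p → Valid M p → ¬ Red i p → succ M' i (sh p) ≡ sh (succ M i p)
  succ-shift i (pos j s t) (jk , tl) nr with (s ≟S s0) ×-dec (j ≟ j0)
  ... | yes (refl , refl) = succ-shift-same i t tl nr
  ... | no ne = succ-shift-other i j s t jk tl ne nr

  succ-redirected : ∀ i p → Red i p → succ M' i (sh p) ≡ new
  succ-redirected i p (inj₁ (t' , e , refl)) rewrite shift-lt s0 j0 t0 t' (subst (t' <_) (sym e) (n<1+n t'))
    = trans (advance-yes M' i s0 j0 (suc t') (lt-len' (subst (_≤ len M s0 j0) e t0l))) (cong (pos j0 s0) (sym e))
  succ-redirected i p (inj₂ (t0z , inj₁ (refl , refl , refl)))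
    rewrite shift-ne F j0 t0 j0 H (pred (h M j0)) (λ { (() , _) })
    = trans (succ-out-T M' wf' j0) (trans (onSeg-yes M' F j0 0 (lt-len' z≤n)) (cong (pos j0 F) (sym t0z)))
  succ-redirected i p (inj₂ (t0z , inj₂ (refl , refl , refl)))
    rewrite shift-ne B j0 t0 (next K j0) H (pred (h M (next K j0))) (λ { (() , _) })
    = trans (succ-out-F M' wf' (next K j0))
       (trans (cong (λ z → onSeg M' B z 0) (prev-next j0 j0k))
       (trans (onSeg-yes M' B j0 0 (lt-len' z≤n)) (cong (pos j0 B) (sym t0z))))

  succ-new : ∀ i → succ M' i new ≡ sh (advance M i s0 j0 t0)
  succ-new i = go (t0 <? len M s0 j0)
    where
    go : Dec (t0 < len M s0 j0) → advance M' i s0 j0 (suc t0) ≡ sh (advance M i s0 j0 t0)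
    go (yes a) rewrite advance-yes M' i s0 j0 (suc t0) (lt-len' a) | advance-yes M i s0 j0 t0 a
      = sym (shift-ge s0 j0 t0 t0 ≤-refl)
    go (no a) rewrite advance-no M' i s0 j0 (suc t0) (λ z → a (≤-pred (subst (λ w → _ < w) len'≡ z)))
                    | advance-no M i s0 j0 t0 a = exit-shift i s0 j0 j0k (noExcH i)

record Labelling (n : ℕ) (A : Fin n → Fin n → Bool) (M : Model) : Set where
  field
    lab : Fin n → Pos
    lab-inj : ∀ a b → lab a ≡ lab b → a ≡ b
    lab-valid : ∀ a → Valid M (lab a)
    surj : ∀ p → Valid M p → Σ (Fin n) λ a → lab a ≡ p
    arc→ : ∀ a b → A a b ≡ true → MArc M (lab a) (lab b)
    →arc : ∀ a b → MArc M (lab a) (lab b) → A a b ≡ true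

Realisation : Digraph → Set
Realisation G = Σ Model λ M → WF M × Labelling (size G) (Arc G) M

_≟P_ : (p q : Pos) → Dec (p ≡ q)
pos j s t ≟P pos j' s' t' with j ≟ j' | s ≟S s' | t ≟ t'
... | yes refl | yes refl | yes refl = yes refl
... | no a | _ | _ = no (λ e → a (pos-injʲ e))
... | yes _ | no a | _ = no (λ e → a (pos-injˢ e))
... | yes _ | yes _ | no a = no (λ e → a (pos-injᵗ e))

MArc-map : ∀ M M' p q p' q' → (∀ i → q ≡ succ M i p → q' ≡ succ M' i p') → MArc M p q → MArc M' p' q'
MArc-map M M' p q p' q' g (inj₁ e) = inj₁ (g true e)
MArc-map M M' p q p' q' g (inj₂ e) = inj₂ (g false e)

MArc-elim : ∀ M p q {C : Set} → (∀ i → q ≡ succ M i p → C) → MArc M p q → C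
MArc-elim M p q g (inj₁ e) = g true e
MArc-elim M p q g (inj₂ e) = g false e

MArc-i : ∀ {M p q} i → q ≡ succ M i p → MArc M p q
MArc-i true e = inj₁ e
MArc-i false e = inj₂ e

∧-true : ∀ {x y} → x ∧ y ≡ true → x ≡ true × y ≡ true
∧-true {true} {true} _ = refl , refl

true-dec : ∀ {n} (a x : Fin n) → ⌊ a ≟F x ⌋ ≡ true → a ≡ x
true-dec a x e with a ≟F x
... | yes q = q
... | no _ = ⊥-elim (false≢true e)
  where false≢true : false ≢ true
        false≢true ()

-- A labelling of G by M extends to a labelling of a split of G by M' once
-- the arcs through the new position are known to be the right ones.
module SplitCommon (G : Digraph) (M : Model) (wf : WF M) (L : Labelling (size G) (Arc G) M)
                   (s0 : Seg) (j0 t0 : ℕ) (j0k : j0 < k M) (t0l : t0 ≤ len M s0 j0) (hpos : s0 ≡ H → 0 < t0)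
                   (x : Fin (size G)) where
  open Labelling L
  open InsLemmas M wf s0 j0 t0 j0k t0l hpos public

  lab' : Fin (suc (size G)) → Pos
  lab' zero = new
  lab' (suc a) = sh (lab a)

  lab'-inj : ∀ a b → lab' a ≡ lab' b → a ≡ b
  lab'-inj zero zero e = refl
  lab'-inj zero (suc b) e = ⊥-elim (new≢shift s0 j0 t0 (lab b) e)
  lab'-inj (suc a) zero e = ⊥-elim (new≢shift s0 j0 t0 (lab a) (sym e))
  lab'-inj (suc a) (suc b) e = cong suc (lab-inj a b (shift-inj s0 j0 t0 _ _ e))

  lab'-valid : ∀ a → Valid M' (lab' a)
  lab'-valid zero = valid-new
  lab'-valid (suc a) = valid-sh (lab a) (lab-valid a)

  lab'-surj : ∀ q → Valid M' q → Σ (Fin (suc (size G))) λ a → lab' a ≡ q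
  lab'-surj q v with shift-surj q v
  ... | inj₁ e = zero , sym e
  ... | inj₂ (p , vp , e) = suc (proj₁ (surj p vp)) , trans (cong sh (proj₂ (surj p vp))) e

  nored-arc : ∀ i a b → ¬ Red i (lab a) → lab b ≡ succ M i (lab a) → sh (lab b) ≡ succ M' i (sh (lab a))
  nored-arc i a b nr e = trans (cong sh e) (sym (succ-shift i (lab a) (lab-valid a) nr))

  arc-nored : ∀ i a b → ¬ Red i (lab a) → sh (lab b) ≡ succ M' i (sh (lab a)) → lab b ≡ succ M i (lab a)
  arc-nored i a b nr e = shift-inj s0 j0 t0 _ _ (trans e (succ-shift i (lab a) (lab-valid a) nr))

  new-nored : ∀ i a → ¬ Red i (lab a) → new ≢ succ M' i (sh (lab a))
  new-nored i a nr e = new≢shift s0 j0 t0 (succ M i (lab a)) (trans e (succ-shift i (lab a) (lab-valid a) nr))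

  -- Vertex splitting: the redirected arcs are exactly the arcs out of x
  -- (hR, hRx), and the new position has the old successors of x (hN).
  module VSplit (hR : ∀ i a → Red i (lab a) → a ≡ x) (hRx : ∀ i → Red i (lab x))
                (hN : ∀ i → succ M' i new ≡ sh (succ M i (lab x))) where
    a→ : ∀ a b → Arc (splitVertex G x) a b ≡ true → MArc M' (lab' a) (lab' b)
    a→ zero zero ()
    a→ zero (suc b) e = MArc-map M M' (lab x) (lab b) new (sh (lab b)) (λ i e' → trans (cong sh e') (sym (hN i))) (arc→ x b e)
    a→ (suc a) zero e with true-dec a x e
    ... | refl = MArc-i {M = M'} {p = sh (lab x)} {q = new} true (sym (succ-redirected true (lab x) (hRx true)))
    a→ (suc a) (suc b) e with a ≟F x
    a→ (suc a) (suc b) () | yes _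
    ... | no ne = MArc-map M M' (lab a) (lab b) (sh (lab a)) (sh (lab b)) (λ i e' → nored-arc i a b (λ r → ne (hR i a r)) e') (arc→ a b e)

    →a : ∀ a b → MArc M' (lab' a) (lab' b) → Arc (splitVertex G x) a b ≡ true
    →a zero zero m = ⊥-elim (MArc-elim M' new new (λ i e → new≢shift s0 j0 t0 (succ M i (lab x)) (trans e (hN i))) m)
    →a zero (suc b) m = →arc x b (MArc-map M' M new (sh (lab b)) (lab x) (lab b) (λ i e → shift-inj s0 j0 t0 _ _ (trans e (hN i))) m)
    →a (suc a) zero m with a ≟F x
    ... | yes _ = refl
    ... | no ne = ⊥-elim (MArc-elim M' (sh (lab a)) new (λ i e → new-nored i a (λ r → ne (hR i a r)) e) m)
    →a (suc a) (suc b) m with a ≟F x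
    ... | yes refl = ⊥-elim (MArc-elim M' (sh (lab x)) (sh (lab b)) (λ i e → new≢shift s0 j0 t0 (lab b) (sym (trans e (succ-redirected i (lab x) (hRx i))))) m)
    ... | no ne = →arc a b (MArc-map M' M (sh (lab a)) (sh (lab b)) (lab a) (lab b) (λ i e → arc-nored i a b (λ r → ne (hR i a r)) e) m)

    lab-split : Labelling (suc (size G)) (Arc (splitVertex G x)) M'
    lab-split = record { lab = lab' ; lab-inj = lab'-inj ; lab-valid = lab'-valid ; surj = lab'-surj
                       ; arc→ = a→ ; →arc = →a }

  -- Arc splitting: redirected arcs leave x (hR) and are exactly the arcs
  -- from x to y (hR2, hR3); the new position leads to y (hN).
  module ASplit (y : Fin (size G)) (hxy : Arc G x y ≡ true)
                (hR : ∀ i a → Red i (lab a) → a ≡ x)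
                (hR2 : ∀ i → Red i (lab x) → lab y ≡ succ M i (lab x))
                (hR3 : ∀ i → lab y ≡ succ M i (lab x) → Red i (lab x))
                (hN : ∀ i → succ M' i new ≡ sh (lab y)) where
    ∧true : ∀ {z} → z ≡ true → z ∧ true ≡ true
    ∧true refl = refl

    a→ : ∀ a b → Arc (splitArc G x y) a b ≡ true → MArc M' (lab' a) (lab' b)
    a→ zero zero ()
    a→ zero (suc b) e with true-dec b y e
    ... | refl = MArc-i {M = M'} {p = new} {q = sh (lab y)} true (sym (hN true))
    a→ (suc a) zero e with true-dec a x e
    ... | refl = MArc-elim M (lab x) (lab y)
                   (λ i e' → MArc-i {M = M'} {p = sh (lab x)} {q = new} i (sym (succ-redirected i (lab x) (hR3 i e'))))
                   (arc→ x y hxy)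
    a→ (suc a) (suc b) e with a ≟F x | b ≟F y
    ... | no ne | _ = MArc-map M M' (lab a) (lab b) (sh (lab a)) (sh (lab b))
                        (λ i e' → nored-arc i a b (λ r → ne (hR i a r)) e') (arc→ a b (proj₁ (∧-true e)))
    ... | yes refl | no nb = MArc-map M M' (lab x) (lab b) (sh (lab x)) (sh (lab b))
                        (λ i e' → nored-arc i x b (λ r → nb (lab-inj b y (trans e' (sym (hR2 i r))))) e')
                        (arc→ x b (proj₁ (∧-true e)))
    ... | yes refl | yes refl with proj₂ (∧-true {Arc G x y} e)
    ...   | ()

    notRed : ∀ i → lab y ≢ succ M i (lab x) → ¬ Red i (lab x)
    notRed i ne r = ne (hR2 i r)

    →a : ∀ a b → MArc M' (lab' a) (lab' b) → Arc (splitArc G x y) a b ≡ true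
    →a zero zero m = ⊥-elim (MArc-elim M' new new (λ i e → new≢shift s0 j0 t0 (lab y) (trans e (hN i))) m)
    →a zero (suc b) m with b ≟F y
    ... | yes _ = refl
    ... | no nb = ⊥-elim (MArc-elim M' new (sh (lab b))
                    (λ i e → nb (lab-inj b y (shift-inj s0 j0 t0 _ _ (trans e (hN i))))) m)
    →a (suc a) zero m with a ≟F x
    ... | yes _ = refl
    ... | no ne = ⊥-elim (MArc-elim M' (sh (lab a)) new (λ i e → new-nored i a (λ r → ne (hR i a r)) e) m)
    →a (suc a) (suc b) m with a ≟F x | b ≟F y
    ... | no ne | _ = ∧true (→arc a b (MArc-map M' M (sh (lab a)) (sh (lab b)) (lab a) (lab b)
                        (λ i e → arc-nored i a b (λ r → ne (hR i a r)) e) m))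
    ... | yes refl | yes refl = ⊥-elim (MArc-elim M' (sh (lab x)) (sh (lab y)) g m)
      where
      g : ∀ i → sh (lab y) ≡ succ M' i (sh (lab x)) → ⊥
      g i e with lab y ≟P succ M i (lab x)
      ... | yes q = new≢shift s0 j0 t0 (lab y) (sym (trans e (succ-redirected i (lab x) (hR3 i q))))
      ... | no q = q (arc-nored i x y (notRed i q) e)
    ... | yes refl | no nb = ∧true (→arc x b (MArc-map M' M (sh (lab x)) (sh (lab b)) (lab x) (lab b) g m))
      where
      g : ∀ i → sh (lab b) ≡ succ M' i (sh (lab x)) → lab b ≡ succ M i (lab x)
      g i e with lab y ≟P succ M i (lab x)
      ... | yes q = ⊥-elim (new≢shift s0 j0 t0 (lab b) (sym (trans e (succ-redirected i (lab x) (hR3 i q)))))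
      ... | no q = arc-nored i x b (notRed i q) e

    lab-split : Labelling (suc (size G)) (Arc (splitArc G x y)) M'
    lab-split = record { lab = lab' ; lab-inj = lab'-inj ; lab-valid = lab'-valid ; surj = lab'-surj
                       ; arc→ = a→ ; →arc = →a }

-- Splitting a vertex x at position (j0, s0, t) of a realisation inserts a
-- position right after it: the new vertex w is the second half of x.
realise-splitVertex : (G : Digraph) → Realisation G → (x : Fin (size G)) → Realisation (splitVertex G x)
realise-splitVertex G (M , wf , L) x = go (Labelling.lab L x) refl
  where
  open Labelling L
  go : (p : Pos) → lab x ≡ p → Realisation (splitVertex G x)
  go (pos j0 s0 t) ex = M' , wf' , lab-split
    where
    v = subst (Valid M) ex (lab-valid x)
    open SplitCommon G M wf L s0 j0 (suc t) (proj₁ v) (proj₂ v) (λ _ → s≤s z≤n) x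
    hR : ∀ i a → Red i (lab a) → a ≡ x
    hR i a (inj₁ (t' , e , eq)) = lab-inj a x (trans eq (trans (cong (pos j0 s0) (sym (suc-injective e))) (sym ex)))
    hR i a (inj₂ (() , _))
    hRx : ∀ i → Red i (lab x)
    hRx i = inj₁ (t , refl , ex)
    hN : ∀ i → succ M' i new ≡ sh (succ M i (lab x))
    hN i rewrite ex = succ-new i
    open VSplit hR hRx hN

-- If x is not an
-- out-vertex, the new position goes right after x on its path; if x is
-- out(j), it becomes the first position of the F-segment of j or of the
-- B-segment of prev j, according to the direction of the arc.
module SplitArcCases (G : Digraph) (M : Model) (wf : WF M) (L : Labelling (size G) (Arc G) M)
                     (x y : Fin (size G)) (hxy : Arc G x y ≡ true) where
  open Labelling L
  private
    ay = arc→ x y hxy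

  from-inner : ∀ jx sx tx → lab x ≡ pos jx sx tx → ¬ IsOut M (lab x) → Realisation (splitArc G x y)
  from-inner jx sx tx ex nout = M' , wf' , lab-split
    where
    v = subst (Valid M) ex (lab-valid x)
    open SplitCommon G M wf L sx jx (suc tx) (proj₁ v) (proj₂ v) (λ _ → s≤s z≤n) x
    same : succ M true (lab x) ≡ succ M false (lab x)
    same = succ-nonout M wf (lab x) (lab-valid x) nout
    ally : ∀ i → lab y ≡ succ M i (lab x)
    ally true = [ (λ e → e) , (λ e → trans e (sym same)) ]′ ay
    ally false = [ (λ e → trans e same) , (λ e → e) ]′ ay
    hR : ∀ i a → Red i (lab a) → a ≡ x
    hR i a (inj₁ (t' , e , eq)) = lab-inj a x (trans eq (trans (cong (pos jx sx) (sym (suc-injective e))) (sym ex)))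
    hR i a (inj₂ (() , _))
    hN : ∀ i → succ M' i new ≡ sh (lab y)
    hN i = trans (succ-new i) (cong sh (trans (cong (succ M i) (sym ex)) (sym (ally i))))
    open ASplit y hxy hR (λ i _ → ally i) (λ i _ → inj₁ (tx , refl , ex)) hN

  private
    out-distinct : ∀ jx → jx < k M → lab x ≡ outP M jx → succ M true (lab x) ≢ succ M false (lab x)
    out-distinct jx jxk eo e = succ-out-distinct M wf jx jxk (subst (λ z → succ M true z ≡ succ M false z) eo e)

  from-out-forward : ∀ jx → jx < k M → lab x ≡ outP M jx → lab y ≡ succ M true (lab x) → Realisation (splitArc G x y)
  from-out-forward jx jxk eo ey = M' , wf' , lab-split
    where
    open SplitCommon G M wf L F jx 0 jxk z≤n (λ ()) x
    hR : ∀ i a → Red i (lab a) → a ≡ x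
    hR i a (inj₁ (t' , () , _))
    hR i a (inj₂ (_ , inj₁ (_ , _ , eq))) = lab-inj a x (trans eq (sym eo))
    hR i a (inj₂ (_ , inj₂ (_ , () , _)))
    hR2 : ∀ i → Red i (lab x) → lab y ≡ succ M i (lab x)
    hR2 i (inj₁ (t' , () , _))
    hR2 i (inj₂ (_ , inj₁ (refl , _ , _))) = ey
    hR2 i (inj₂ (_ , inj₂ (_ , () , _)))
    hR3 : ∀ i → lab y ≡ succ M i (lab x) → Red i (lab x)
    hR3 true e = inj₂ (refl , inj₁ (refl , refl , eo))
    hR3 false e = ⊥-elim (out-distinct jx jxk eo (trans (sym ey) e))
    hN : ∀ i → succ M' i new ≡ sh (lab y)
    hN i = trans (succ-new i) (cong sh (trans (advance-FB M i F jx 0 (λ ()))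
             (trans (sym (succ-out-T M wf jx)) (trans (cong (succ M true) (sym eo)) (sym ey)))))
    open ASplit y hxy hR hR2 hR3 hN

  from-out-backward : ∀ jx → jx < k M → lab x ≡ outP M jx → lab y ≡ succ M false (lab x) → Realisation (splitArc G x y)
  from-out-backward jx jxk eo ey = M' , wf' , lab-split
    where
    open SplitCommon G M wf L B (prev (k M) jx) 0 (prev<k jx jxk) z≤n (λ ()) x
    eo' : lab x ≡ outP M (next K (prev K jx))
    eo' = trans eo (cong (outP M) (sym (next-prev jx jxk)))
    hR : ∀ i a → Red i (lab a) → a ≡ x
    hR i a (inj₁ (t' , () , _))
    hR i a (inj₂ (_ , inj₁ (_ , () , _)))
    hR i a (inj₂ (_ , inj₂ (_ , _ , eq))) = lab-inj a x (trans eq (sym eo'))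
    hR2 : ∀ i → Red i (lab x) → lab y ≡ succ M i (lab x)
    hR2 i (inj₁ (t' , () , _))
    hR2 i (inj₂ (_ , inj₁ (_ , () , _)))
    hR2 i (inj₂ (_ , inj₂ (refl , _ , _))) = ey
    hR3 : ∀ i → lab y ≡ succ M i (lab x) → Red i (lab x)
    hR3 false e = inj₂ (refl , inj₂ (refl , refl , eo'))
    hR3 true e = ⊥-elim (out-distinct jx jxk eo (trans (sym e) ey))
    hN : ∀ i → succ M' i new ≡ sh (lab y)
    hN i = trans (succ-new i) (cong sh (trans (advance-FB M i B (prev K jx) 0 (λ ()))
             (trans (sym (succ-out-F M wf jx)) (trans (cong (succ M false) (sym eo)) (sym ey)))))
    open ASplit y hxy hR hR2 hR3 hN

realise-splitArc : (G : Digraph) → Realisation G → (x y : Fin (size G)) → Arc G x y ≡ true → Realisation (splitArc G x y)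
realise-splitArc G (M , wf , L) x y hxy = go (lab x) refl
  where
  open Labelling L
  open SplitArcCases G M wf L x y hxy
  go : (p : Pos) → lab x ≡ p → Realisation (splitArc G x y)
  go (pos jx sx tx) ex with (sx ≟S H) ×-dec (suc tx ≟ h M jx)
  ... | yes (refl , e) = [ from-out-forward jx jxk eo , from-out-backward jx jxk eo ]′ (arc→ x y hxy)
    where
    eo : lab x ≡ outP M jx
    eo = trans ex (cong (pos jx H) (cong pred e))
    jxk = proj₁ (subst (Valid M) ex (lab-valid x))
  ... | no nout = from-inner jx sx tx ex (λ o → nout (subst (IsOut M) ex o))

-- Double cycles are realised by the normal form with hub paths of length
-- one and empty segments; first some Boolean bookkeeping.

eqb : ∀ {m n} → (m ≡ᵇ n) ≡ true → m ≡ n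
eqb {m} {n} e = ≡ᵇ⇒≡ m n (Equivalence.from T-≡ e)

beq : ∀ {m n} → m ≡ n → (m ≡ᵇ n) ≡ true
beq {m} {n} e = Equivalence.to T-≡ (≡⇒≡ᵇ m n e)

∨-l : ∀ {p q} → p ≡ true → p ∨ q ≡ true
∨-l refl = refl
∨-r : ∀ {p q} → q ≡ true → p ∨ q ≡ true
∨-r {true} _ = refl
∨-r {false} e = e
∧-t : ∀ {p q} → p ≡ true → q ≡ true → p ∧ q ≡ true
∧-t refl refl = refl
∨-split : ∀ {p q} → p ∨ q ≡ true → p ≡ true ⊎ q ≡ true
∨-split {true} _ = inj₁ refl
∨-split {false} e = inj₂ e

cyc→ : ∀ m I J → I < m → J < m →
  (J ≡ᵇ suc I) ∨ (I ≡ᵇ suc J) ∨ ((J ≡ᵇ 0) ∧ (suc I ≡ᵇ m)) ∨ ((I ≡ᵇ 0) ∧ (suc J ≡ᵇ m)) ≡ true →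
  J ≡ next m I ⊎ J ≡ prev m I
cyc→ m I J Im Jm e with ∨-split {J ≡ᵇ suc I} e
... | inj₁ e1 = inj₁ (trans (eqb e1) (sym (next-yes (subst (_< m) (eqb e1) Jm))))
... | inj₂ e2 with ∨-split {I ≡ᵇ suc J} e2
...   | inj₁ e3 = inj₂ (prev-suc (eqb {I} {suc J} e3))
  where prev-suc : ∀ {I J} → I ≡ suc J → J ≡ prev m I
        prev-suc refl = refl
...   | inj₂ e4 with ∨-split {(J ≡ᵇ 0) ∧ (suc I ≡ᵇ m)} e4
...     | inj₁ e5 = inj₁ (trans (eqb (proj₁ (∧-true e5)))
                        (sym (next-no (λ z → <-irrefl (eqb (proj₂ (∧-true {J ≡ᵇ 0} e5))) z))))
...     | inj₂ e6 = inj₂ (pv0 (eqb {I} {0} (proj₁ (∧-true {I ≡ᵇ 0} e6))) (eqb {suc J} {m} (proj₂ (∧-true {I ≡ᵇ 0} e6))))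
  where pv0 : ∀ {I J} → I ≡ 0 → suc J ≡ m → J ≡ prev m I
        pv0 refl e = cong pred e

cyc← : ∀ m I J → I < m → J < m → 0 < m → J ≡ next m I ⊎ J ≡ prev m I →
  (J ≡ᵇ suc I) ∨ (I ≡ᵇ suc J) ∨ ((J ≡ᵇ 0) ∧ (suc I ≡ᵇ m)) ∨ ((I ≡ᵇ 0) ∧ (suc J ≡ᵇ m)) ≡ true
cyc← m I J Im Jm 0m (inj₁ e) = go (suc I <? m)
  where
  go : Dec (suc I < m) → (J ≡ᵇ suc I) ∨ (I ≡ᵇ suc J) ∨ ((J ≡ᵇ 0) ∧ (suc I ≡ᵇ m)) ∨ ((I ≡ᵇ 0) ∧ (suc J ≡ᵇ m)) ≡ true
  go (yes p) = ∨-l (beq (trans e (next-yes p)))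
  go (no p) = ∨-r {J ≡ᵇ suc I} (∨-r {I ≡ᵇ suc J} (∨-l (∧-t (beq (trans e (next-no p))) (beq (lt-eq Im p)))))
cyc← m zero J Im Jm 0m (inj₂ e) =
  ∨-r {J ≡ᵇ 1} (∨-r {0 ≡ᵇ suc J} (∨-r {(J ≡ᵇ 0) ∧ (1 ≡ᵇ m)} (∧-t refl (beq (trans (cong suc e) (sucpred m 0m))))))
cyc← m (suc I) J Im Jm 0m (inj₂ e) = ∨-r {J ≡ᵇ suc (suc I)} (∨-l (beq (cong suc (sym e))))

M0 : ℕ → Model
M0 m = model m (λ _ → 1) (λ _ → 0) (λ _ → 0)

base-T : ∀ m a → succ (M0 m) true (pos a H 0) ≡ pos (next m a) H 0
base-T m a = trans (advance-no (M0 m) true H a 1 (λ { (s≤s ()) })) (onSeg-no (M0 m) F a 0 (λ ()))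

base-F : ∀ m a → succ (M0 m) false (pos a H 0) ≡ pos (prev m a) H 0
base-F m a = trans (advance-no (M0 m) false H a 1 (λ { (s≤s ()) })) (onSeg-no (M0 m) B (prev m a) 0 (λ ()))

realise-doubleCycle : ∀ m → 3 ≤ m → Realisation (doubleCycle m)
realise-doubleCycle m 3m = M0 m , record { k≥3 = 3m ; h>0 = λ _ → s≤s z≤n } , L
  where
  0m : 0 < m
  0m = ≤-trans (s≤s z≤n) 3m
  lab : Fin m → Pos
  lab i = pos (toℕ i) H 0
  sj : ∀ p → Valid (M0 m) p → Σ (Fin m) λ a → lab a ≡ p
  sj (pos j H zero) (jk , _) = fromℕ< jk , cong (λ z → pos z H 0) (toℕ-fromℕ< jk)
  sj (pos j H (suc t)) (jk , s≤s ())
  sj (pos j F t) (jk , ())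
  sj (pos j B t) (jk , ())
  L : Labelling m (Arc (doubleCycle m)) (M0 m)
  L = record
    { lab = lab
    ; lab-inj = λ a b e → toℕ-injective (pos-injʲ e)
    ; lab-valid = λ a → toℕ<n a , s≤s z≤n
    ; surj = sj
    ; arc→ = λ a b e → Data.Sum.map (λ z → trans (cong (λ w → pos w H 0) z) (sym (base-T m (toℕ a))))
                                    (λ z → trans (cong (λ w → pos w H 0) z) (sym (base-F m (toℕ a))))
                                    (cyc→ m (toℕ a) (toℕ b) (toℕ<n a) (toℕ<n b) e)
    ; →arc = λ a b e → cyc← m (toℕ a) (toℕ b) (toℕ<n a) (toℕ<n b) 0m
               (Data.Sum.map (λ z → pos-injʲ (trans z (base-T m (toℕ a))))
                             (λ z → pos-injʲ (trans z (base-F m (toℕ a)))) e)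
    }

realise-splittable : ∀ {G} → Splittable G → Realisation G
realise-splittable (double m p) = realise-doubleCycle m p
realise-splittable (vsplit s x) = realise-splitVertex _ (realise-splittable s) x
realise-splittable (asplit s x y e) = realise-splitArc _ (realise-splittable s) x y e

realise-iso : ∀ {HH G} → Realisation HH → Iso HH G → Realisation G
realise-iso {HH} {G} (M , wf , L) I = M , wf , record
  { lab = λ c → lab (from c)
  ; lab-inj = λ c d e → trans (sym (strictlyInverseˡ c)) (trans (cong to (lab-inj _ _ e)) (strictlyInverseˡ d))
  ; lab-valid = λ c → lab-valid (from c)
  ; surj = λ p v → to (proj₁ (surj p v)) , trans (cong lab (strictlyInverseʳ _)) (proj₂ (surj p v))
  ; arc→ = λ c d e → arc→ (from c) (from d) (trans (preserve (from c) (from d)) (subst₂ (λ u w → Arc G u w ≡ true) (sym (strictlyInverseˡ c)) (sym (strictlyInverseˡ d)) e))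
  ; →arc = λ c d m → subst₂ (λ u w → Arc G u w ≡ true) (strictlyInverseˡ c) (strictlyInverseˡ d) (trans (sym (preserve (from c) (from d))) (→arc (from c) (from d) m))
  }
  where
  open Labelling L
  open Iso I
  open Inverse bij

realise-wdc : ∀ G → WDC G → Realisation G
realise-wdc G (HH , s , I) = realise-iso (realise-splittable s) I

module LocalShape {V : Set} (A : V → V → Set) where
  UIn : V → V → Set
  UIn v u = A u v × (∀ w → A w v → w ≡ u)
  UOut : V → V → Set
  UOut v u = A v u × (∀ w → A v w → w ≡ u)
  TwoIn : V → Set
  TwoIn v = Σ V λ u1 → Σ V λ u2 → u1 ≢ u2 × A u1 v × A u2 v
  TwoOut : V → Set
  TwoOut v = Σ V λ u1 → Σ V λ u2 → u1 ≢ u2 × A v u1 × A v u2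
  Int : V → Set
  Int v = Σ V (λ u → UIn v u) × Σ V (λ w → UOut v w)
  NonInt : V → Set
  NonInt v = TwoIn v ⊎ TwoOut v

  two-uin : ∀ {v u} → TwoIn v → UIn v u → ⊥
  two-uin (u1 , u2 , ne , a1 , a2) (_ , un) = ne (trans (un u1 a1) (sym (un u2 a2)))
  two-uout : ∀ {v u} → TwoOut v → UOut v u → ⊥
  two-uout (u1 , u2 , ne , a1 , a2) (_ , un) = ne (trans (un u1 a1) (sym (un u2 a2)))
  nonint-int : ∀ {v} → NonInt v → Int v → ⊥
  nonint-int (inj₁ t) ((u , ui) , _) = two-uin t ui
  nonint-int (inj₂ t) (_ , (w , uo)) = two-uout t uo

  uin-arc : ∀ {v u w} → UIn v u → A w v → UIn v w
  uin-arc (a , un) aw = aw , λ z az → trans (un z az) (sym (un _ aw))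

  module Skew (σ : V → V) (inv : ∀ v → σ (σ v) ≡ v) (skew : ∀ a b → A a b → A (σ b) (σ a)) where
    σ-inj : ∀ {a b} → σ a ≡ σ b → a ≡ b
    σ-inj {a} {b} e = trans (sym (inv a)) (trans (cong σ e) (inv b))

    σ-UIn : ∀ {v u} → UIn v u → UOut (σ v) (σ u)
    σ-UIn {v} {u} (a , un) = skew _ _ a , λ w aw → trans (sym (inv w)) (cong σ (un (σ w) (subst (A (σ w)) (inv v) (skew _ _ aw))))
    σ-UOut : ∀ {v u} → UOut v u → UIn (σ v) (σ u)
    σ-UOut {v} {u} (a , un) = skew _ _ a , λ w aw → trans (sym (inv w)) (cong σ (un (σ w) (subst (λ z → A z (σ w)) (inv v) (skew _ _ aw))))
    σ-TwoIn : ∀ {v} → TwoIn v → TwoOut (σ v)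
    σ-TwoIn (u1 , u2 , ne , a1 , a2) = σ u1 , σ u2 , (λ e → ne (σ-inj e)) , skew _ _ a1 , skew _ _ a2
    σ-TwoOut : ∀ {v} → TwoOut v → TwoIn (σ v)
    σ-TwoOut (u1 , u2 , ne , a1 , a2) = σ u1 , σ u2 , (λ e → ne (σ-inj e)) , skew _ _ a1 , skew _ _ a2
    σ-Int : ∀ {v} → Int v → Int (σ v)
    σ-Int ((u , ui) , (w , uo)) = (σ w , σ-UOut uo) , (σ u , σ-UIn ui)
    σ-NonInt : ∀ {v} → NonInt v → NonInt (σ v)
    σ-NonInt (inj₁ t) = inj₂ (σ-TwoIn t)
    σ-NonInt (inj₂ t) = inj₁ (σ-TwoOut t)

    module PathReflection (p q : ℕ → V) (n' m' : ℕ)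
      (parc : ∀ i → i < suc n' → A (p i) (p (suc i)))
      (pint : ∀ i → 0 < i → i < suc n' → Int (p i))
      (p0 : NonInt (p 0))
      (qarc : ∀ i → i < suc m' → A (q i) (q (suc i)))
      (qint : ∀ i → 0 < i → i < suc m' → Int (q i))
      (qm : NonInt (q (suc m')))
      (q0 : q 0 ≡ σ (p (suc n')))
      (q1 : q 1 ≡ σ (p n')) where

      -- Inductively q i = σ (p j) for i + j = n'+1: σ (p (j+1)) has the
      -- unique out-neighbour σ (p j) because p (j+1) is interior.
      reflect-step : ∀ i j → suc i + suc j ≡ suc n' → suc (suc i) ≤ suc m' → q (suc i) ≡ σ (p (suc j)) → q (suc (suc i)) ≡ σ (p j)
      reflect-step i j e' le ih = proj₂ uo (q (suc (suc i))) (subst (λ z → A z (q (suc (suc i)))) ih (qarc (suc i) le))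
        where
        sj<n : suc j < suc n'
        sj<n = subst (suc j <_) e' (s≤s (m≤n+m (suc j) i))
        ui : UIn (p (suc j)) (p j)
        ui = uin-arc (proj₂ (proj₁ (pint (suc j) (s≤s z≤n) sj<n))) (parc j (<-trans (n<1+n j) sj<n))
        uo : UOut (σ (p (suc j))) (σ (p j))
        uo = σ-UIn ui

      reflected-prefix : ∀ i j → i + j ≡ suc n' → i ≤ suc m' → q i ≡ σ (p j)
      reflected-prefix zero j e _ = trans q0 (cong (λ z → σ (p z)) (sym e))
      reflected-prefix (suc zero) j e _ = trans q1 (cong (λ z → σ (p z)) (sym (suc-injective e)))
      reflected-prefix (suc (suc i)) j e le = reflect-step i j (trans (+-suc (suc i) j) e) le
                                 (reflected-prefix (suc i) (suc j) (trans (+-suc (suc i) j) e) (≤-trans (n≤1+n _) le))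

      -- Comparing where the first non-interior vertex occurs on each side.
      same-length : suc n' ≡ suc m'
      same-length with <-cmp (suc n') (suc m')
      ... | tri≈ _ e _ = e
      ... | tri< lt _ _ = ⊥-elim (nonint-int (subst NonInt (sym (reflected-prefix (suc n') 0 (+-identityʳ _) (<⇒≤ lt))) (σ-NonInt p0))
                                             (qint (suc n') (s≤s z≤n) lt))
      ... | tri> _ _ gt = ⊥-elim (nonint-int qm (subst Int (sym cm) (σ-Int (pint d dpos dlt))))
        where
        d = suc n' ∸ suc m'
        de : suc m' + d ≡ suc n'
        de = m+[n∸m]≡n (<⇒≤ gt)
        dpos : 0 < d
        dpos = m<n⇒0<n∸m gt
        dlt : d < suc n'
        dlt = subst (d <_) de (s≤s (m≤n+m d m'))
        cm : q (suc m') ≡ σ (p d)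
        cm = reflected-prefix (suc m') d de ≤-refl

      reflected : ∀ i j → i + j ≡ suc n' → q i ≡ σ (p j)
      reflected i j e = reflected-prefix i j e (subst (i ≤_) same-length (subst (i ≤_) e (m≤m+n i j)))

    -- A fixed-point-free, unit-free σ cannot map a path onto itself
    -- reversed: the middle vertex (or middle arc) would be fixed (or a unit).
    parityN : ∀ n → Σ ℕ (λ i → n ≡ i + i) ⊎ Σ ℕ (λ i → n ≡ suc (i + i))
    parityN zero = inj₁ (0 , refl)
    parityN (suc n) with parityN n
    ... | inj₁ (i , e) = inj₂ (i , cong suc e)
    ... | inj₂ (i , e) = inj₁ (suc i , trans (cong suc e) (cong suc (sym (+-suc i i))))

    no-reverse : (nofix : ∀ v → σ v ≢ v) (unit : ∀ v → A v (σ v) → ⊥) →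
      (p : ℕ → V) (n : ℕ) → (∀ i → i < n → A (p i) (p (suc i))) →
      (∀ i j → i + j ≡ n → σ (p i) ≡ p j) → ⊥
    no-reverse nofix unit p n arc rev with parityN n
    ... | inj₁ (i , e) = nofix (p i) (rev i i (sym e))
    ... | inj₂ (i , e) = unit (p i) (subst (A (p i)) (sym (rev i (suc i) (trans (+-suc i i) (sym e))))
                                       (arc i (subst (i <_) (sym e) (s≤s (m≤m+n i i)))))

module Realised (G : Digraph) (M : Model) (wf : WF M) (L : Labelling (size G) (Arc G) M) where
  open Labelling L public
  V : Set
  V = Fin (size G)
  A : V → V → Set
  A u v = Arc G u v ≡ true
  open LocalShape A public
  K : ℕ
  K = k M
  0<k : 0 < K
  0<k = ≤-trans (s≤s z≤n) (k≥3 wf)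

  valid? : ∀ p → Dec (Valid M p)
  valid? (pos j s t) = (j <? K) ×-dec (t <? len M s j)

  v0 : V
  v0 = proj₁ (surj (inP 0) (inP-valid M wf 0 0<k))

  vtx' : (p : Pos) → Dec (Valid M p) → V
  vtx' p (yes v) = proj₁ (surj p v)
  vtx' p (no _) = v0

  -- The vertex labelled by a position (an arbitrary one if invalid).
  vtx : Pos → V
  vtx p = vtx' p (valid? p)

  lab-vtx : ∀ p → Valid M p → lab (vtx p) ≡ p
  lab-vtx p v = go (valid? p)
    where
    go : (d : Dec (Valid M p)) → lab (vtx' p d) ≡ p
    go (yes v') = proj₂ (surj p v')
    go (no nv) = ⊥-elim (nv v)

  vtx-lab : ∀ a → vtx (lab a) ≡ a
  vtx-lab a = lab-inj _ _ (lab-vtx (lab a) (lab-valid a))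

  vtx-inj : ∀ p q → Valid M p → Valid M q → vtx p ≡ vtx q → p ≡ q
  vtx-inj p q vp vq e = trans (sym (lab-vtx p vp)) (trans (cong lab e) (lab-vtx q vq))

  →A : ∀ p q → Valid M p → Valid M q → MArc M p q → A (vtx p) (vtx q)
  →A p q vp vq m = →arc _ _ (subst₂ (MArc M) (sym (lab-vtx p vp)) (sym (lab-vtx q vq)) m)

  A→ : ∀ {u v} → A u v → MArc M (lab u) (lab v)
  A→ {u} {v} e = arc→ u v e

  isIn? : ∀ p → Dec (IsIn p)
  isIn? (pos j s t) = (s ≟S H) ×-dec (t ≟ 0)

  isOut? : ∀ p → Dec (IsOut M p)
  isOut? (pos j s t) = (s ≟S H) ×-dec (suc t ≟ h M j)

  isIn-inP : ∀ p → IsIn p → p ≡ inP (jOf p)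
  isIn-inP (pos j .H .0) (refl , refl) = refl

  shape-UIn : ∀ v → ¬ IsIn (lab v) → UIn v (vtx (predPos M (lab v)))
  shape-UIn v ni = subst (λ z → A (vtx (predPos M (lab v))) z) (vtx-lab v) a1 , un
    where
    pa = pred-arc M wf (lab v) (lab-valid v) ni
    a1 : A (vtx (predPos M (lab v))) (vtx (lab v))
    a1 = →A _ _ (proj₁ pa) (lab-valid v) (proj₂ pa)
    un : ∀ w → A w v → w ≡ vtx (predPos M (lab v))
    un w aw = trans (sym (vtx-lab w)) (cong vtx (pred-unique M wf (lab w) (lab v) (lab-valid w) (A→ aw) ni))

  shape-UOut : ∀ v → ¬ IsOut M (lab v) → UOut v (vtx (succ M true (lab v)))
  shape-UOut v nout = subst (λ z → A z (vtx (succ M true (lab v)))) (vtx-lab v) a1 , un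
    where
    vv = lab-valid v
    a1 : A (vtx (lab v)) (vtx (succ M true (lab v)))
    a1 = →A _ _ vv (succ-valid M wf true (lab v) vv) (inj₁ refl)
    same = succ-nonout M wf (lab v) vv nout
    un : ∀ w → A v w → w ≡ vtx (succ M true (lab v))
    un w aw = trans (sym (vtx-lab w)) (cong vtx ([ (λ e → e) , (λ e → trans e (sym same)) ]′ (A→ aw)))

  shape-TwoIn : ∀ v → IsIn (lab v) → TwoIn v
  shape-TwoIn v ii = vtx p1 , vtx p2 , (λ e → ne (vtx-inj p1 p2 v1 v2 e)) ,
                 subst (A (vtx p1)) vq (→A _ _ v1 vin a1) , subst (A (vtx p2)) vq (→A _ _ v2 vin a2)
    where
    j = jOf (lab v)
    ein = isIn-inP (lab v) ii
    jk : j < K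
    jk = proj₁ (subst (Valid M) ein (lab-valid v))
    ti = two-in M wf j jk
    p1 = proj₁ ti
    p2 = proj₁ (proj₂ ti)
    v1 = proj₁ (proj₂ (proj₂ ti))
    v2 = proj₁ (proj₂ (proj₂ (proj₂ ti)))
    ne = proj₁ (proj₂ (proj₂ (proj₂ (proj₂ ti))))
    a1 = proj₁ (proj₂ (proj₂ (proj₂ (proj₂ (proj₂ ti)))))
    a2 = proj₂ (proj₂ (proj₂ (proj₂ (proj₂ (proj₂ ti)))))
    vin = inP-valid M wf j jk
    vq : vtx (inP j) ≡ v
    vq = trans (cong vtx (sym ein)) (vtx-lab v)

  shape-TwoOut : ∀ v → IsOut M (lab v) → TwoOut v
  shape-TwoOut v io = vtx s1 , vtx s2 , (λ e → ne (vtx-inj s1 s2 v1 v2 e)) ,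
                  subst (λ z → A z (vtx s1)) (vtx-lab v) (→A _ _ vv v1 (inj₁ refl)) ,
                  subst (λ z → A z (vtx s2)) (vtx-lab v) (→A _ _ vv v2 (inj₂ refl))
    where
    vv = lab-valid v
    s1 = succ M true (lab v)
    s2 = succ M false (lab v)
    v1 = succ-valid M wf true (lab v) vv
    v2 = succ-valid M wf false (lab v) vv
    j = jOf (lab v)
    eo : lab v ≡ outP M j
    eo = go (lab v) io
      where go : ∀ p → IsOut M p → p ≡ outP M (jOf p)
            go (pos j s t) o = isOut-outP M wf j s t o
    jk : j < K
    jk = proj₁ (subst (Valid M) eo vv)
    ne : s1 ≢ s2
    ne e = succ-out-distinct M wf j jk (subst (λ z → succ M true z ≡ succ M false z) eo e)

  shape-Int : ∀ v → ¬ IsIn (lab v) → ¬ IsOut M (lab v) → Int v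
  shape-Int v ni nout = (_ , shape-UIn v ni) , (_ , shape-UOut v nout)

  TwoIn→In : ∀ v → TwoIn v → IsIn (lab v)
  TwoIn→In v t with isIn? (lab v)
  ... | yes i = i
  ... | no ni = ⊥-elim (two-uin t (shape-UIn v ni))

  TwoOut→Out : ∀ v → TwoOut v → IsOut M (lab v)
  TwoOut→Out v t with isOut? (lab v)
  ... | yes i = i
  ... | no ni = ⊥-elim (two-uout t (shape-UOut v ni))

  UOut→¬Out : ∀ {v u} → UOut v u → ¬ IsOut M (lab v)
  UOut→¬Out {v} uo io = two-uout (shape-TwoOut v io) uo

module SegmentPaths (G : Digraph) (M : Model) (wf : WF M) (L : Labelling (size G) (Arc G) M) where
  open Realised G M wf L public

  hp : ℕ → ℕ → V
  hp j i = vtx (pos j H i)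

  lab-hp : ∀ j i → j < K → i < h M j → lab (hp j i) ≡ pos j H i
  lab-hp j i jk il = lab-vtx (pos j H i) (jk , il)

  hub-arc : ∀ j → j < K → ∀ i → suc i < h M j → A (hp j i) (hp j (suc i))
  hub-arc j jk i il = →A _ _ (jk , <-trans (n<1+n i) il) (jk , il) (inj₁ (sym (succ-hub M wf true j i il)))

  hub-int : ∀ j → j < K → ∀ i → 0 < i → suc i < h M j → Int (hp j i)
  hub-int j jk i 0i il = shape-Int (hp j i)
    (λ ii → <-irrefl (sym (proj₂ (subst IsIn e ii))) 0i)
    (λ io → <-irrefl (proj₂ (subst (IsOut M) e io)) il)
    where e = lab-hp j i jk (<-trans (n<1+n i) il)

  hub-in : ∀ j → j < K → NonInt (hp j 0)
  hub-in j jk = inj₁ (shape-TwoIn (hp j 0) (subst IsIn (sym (lab-hp j 0 jk (h>0 wf j))) (refl , refl)))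

  hub-out : ∀ j → j < K → ∀ t → suc t ≡ h M j → NonInt (hp j t)
  hub-out j jk t e = inj₂ (shape-TwoOut (hp j t) (subst (IsOut M) (sym (lab-hp j t jk (subst (t <_) e (n<1+n t)))) (refl , e)))

  data PK : Set where
    PF PB : PK

  ppos : PK → ℕ → ℕ → Pos
  ppos PF j = posF M j
  ppos PB j = posB M j

  plen : PK → ℕ → ℕ
  plen PF j = f M j
  plen PB j = b M j

  pseg : PK → Seg
  pseg PF = F
  pseg PB = B

  pstart : PK → ℕ → ℕ
  pstart PF j = j
  pstart PB j = next K j

  pend : PK → ℕ → ℕ
  pend PF j = next K j
  pend PB j = j

  pbool : PK → Bool
  pbool PF = true
  pbool PB = false

  pend<k : ∀ X j → j < K → pend X j < K
  pend<k PF j jk = next<k j 0<k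
  pend<k PB j jk = jk

  pp-valid : ∀ X j i → j < K → Valid M (ppos X j i)
  pp-valid PF j zero jk = outP-valid M wf j jk
  pp-valid PB j zero jk = outP-valid M wf (next K j) (next<k j 0<k)
  pp-valid PF j (suc i) jk = onSeg-valid M wf F j i (λ ()) jk
  pp-valid PB j (suc i) jk = onSeg-valid M wf B j i (λ ()) jk

  pp-in : ∀ X j i → i < plen X j → ppos X j (suc i) ≡ pos j (pseg X) i
  pp-in PF j i il = onSeg-yes M F j i il
  pp-in PB j i il = onSeg-yes M B j i il

  pp-end : ∀ X j → ppos X j (suc (plen X j)) ≡ inP (pend X j)
  pp-end PF j = onSeg-no M F j (f M j) (n≮n _)
  pp-end PB j = onSeg-no M B j (b M j) (n≮n _)

  pp-second : ∀ X j → j < K → ppos X j 1 ≡ succ M (pbool X) (outP M (pstart X j))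
  pp-second PF j jk = sym (succ-out-T M wf j)
  pp-second PB j jk = sym (trans (succ-out-F M wf (next K j)) (cong (λ z → onSeg M B z 0) (prev-next j jk)))

  pp-marc : ∀ X j i → j < K → i < suc (plen X j) → MArc M (ppos X j i) (ppos X j (suc i))
  pp-marc PF j zero jk _ = inj₁ (pp-second PF j jk)
  pp-marc PB j zero jk _ = inj₂ (pp-second PB j jk)
  pp-marc PF j (suc i) jk (s≤s il) rewrite pp-in PF j i il = inj₁ (sym (succ-F M wf true j i))
  pp-marc PB j (suc i) jk (s≤s il) rewrite pp-in PB j i il = inj₁ (sym (succ-B M wf true j i))

  vp : PK → ℕ → ℕ → V
  vp X j i = vtx (ppos X j i)

  vp-arc : ∀ X j → j < K → ∀ i → i < suc (plen X j) → A (vp X j i) (vp X j (suc i))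
  vp-arc X j jk i il = →A _ _ (pp-valid X j i jk) (pp-valid X j (suc i) jk) (pp-marc X j i jk il)

  pseg≢H : ∀ X → pseg X ≢ H
  pseg≢H PF ()
  pseg≢H PB ()

  vp-int : ∀ X j → j < K → ∀ i → 0 < i → i < suc (plen X j) → Int (vp X j i)
  vp-int X j jk (suc i) _ (s≤s il) = shape-Int (vp X j (suc i))
    (λ ii → pseg≢H X (proj₁ (subst IsIn e ii)))
    (λ io → pseg≢H X (proj₁ (subst (IsOut M) e io)))
    where e = trans (lab-vtx _ (pp-valid X j (suc i) jk)) (pp-in X j i il)

  vp-0 : ∀ X j → j < K → NonInt (vp X j 0)
  vp-0 PF j jk = inj₂ (shape-TwoOut (vp PF j 0) (subst (IsOut M) (sym (lab-vtx _ (pp-valid PF j 0 jk))) (outP-isOut M wf j)))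
  vp-0 PB j jk = inj₂ (shape-TwoOut (vp PB j 0) (subst (IsOut M) (sym (lab-vtx _ (pp-valid PB j 0 jk))) (outP-isOut M wf (next K j))))

  pp-0 : ∀ X j → ppos X j 0 ≡ outP M (pstart X j)
  pp-0 PF j = refl
  pp-0 PB j = refl

  vp-end : ∀ X j → j < K → NonInt (vp X j (suc (plen X j)))
  vp-end X j jk = inj₁ (shape-TwoIn _ (subst IsIn (sym (trans (lab-vtx _ (pp-valid X j _ jk)) (pp-end X j))) (refl , refl)))

  vp-end' : ∀ X j → vp X j (suc (plen X j)) ≡ hp (pend X j) 0
  vp-end' X j = cong vtx (pp-end X j)

  -- The image of a position under a skew-symmetry whose hub permutation
  -- is the rotation by c: hub paths and segments are reflected.
  mirror : ℕ → Pos → V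
  mirror c (pos j H t) = hp (rot K c j) (pred (h M j) ∸ t)
  mirror c (pos j F t) = vp PB (prev K (rot K c (next K j))) (f M j ∸ t)
  mirror c (pos j B t) = vp PF (rot K c j) (f M (rot K c j) ∸ t)

-- A unit-free skew-symmetry σ of a realised digraph.  σ maps out(j) to
-- an in-vertex in(ρ j); this defines the induced permutation ρ of hubs.
module Symmetry (G : Digraph) (M : Model) (wf : WF M) (L : Labelling (size G) (Arc G) M)
          (σ : Fin (size G) → Fin (size G)) (sk : SkewSymmetry G σ) (uf : UnitFree G σ) where
  open SegmentPaths G M wf L public
  open SkewSymmetry sk public
  open Skew σ involutive skew public

  unit : ∀ v → A v (σ v) → ⊥
  unit v e = tf (trans (sym e) (uf v))
    where tf : true ≢ false
          tf ()

  vout : ℕ → V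
  vout j = vtx (outP M j)

  -- The hub permutation: σ (out j) has two in-neighbours, so it is in(ρ j).
  ρ : ℕ → ℕ
  ρ j = jOf (lab (σ (vout j)))

  out-TwoOut : ∀ j → j < K → TwoOut (vout j)
  out-TwoOut j jk = shape-TwoOut (vout j) (subst (IsOut M) (sym (lab-vtx _ (outP-valid M wf j jk))) (outP-isOut M wf j))

  σ-out-lab : ∀ j → j < K → lab (σ (vout j)) ≡ inP (ρ j)
  σ-out-lab j jk = isIn-inP _ (TwoIn→In _ (σ-TwoOut (out-TwoOut j jk)))

  ρ<k : ∀ j → j < K → ρ j < K
  ρ<k j jk = proj₁ (subst (Valid M) (σ-out-lab j jk) (lab-valid (σ (vout j))))

  σ-out : ∀ j → j < K → σ (vout j) ≡ hp (ρ j) 0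
  σ-out j jk = trans (sym (vtx-lab _)) (cong vtx (σ-out-lab j jk))

  HubRes : ℕ → Set
  HubRes j = h M (ρ j) ≡ h M j × (∀ i t → i + t ≡ pred (h M j) → σ (hp j t) ≡ hp (ρ j) i)

  hub-short : ∀ j → j < K → h M j ≡ 1 → HubRes j
  hub-short j jk e = ha1 , mp
    where
    eo : vout j ≡ hp j 0
    eo = cong (λ z → vtx (pos j H (pred z))) e
    tin : TwoIn (vout j)
    tin = subst TwoIn (sym eo) (shape-TwoIn (hp j 0) (subst IsIn (sym (lab-hp j 0 jk (h>0 wf j))) (refl , refl)))
    io : IsOut M (inP (ρ j))
    io = subst (IsOut M) (σ-out-lab j jk) (TwoOut→Out _ (σ-TwoIn tin))
    ha1 : h M (ρ j) ≡ h M j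
    ha1 = trans (sym (proj₂ io)) (sym e)
    mp : ∀ i t → i + t ≡ pred (h M j) → σ (hp j t) ≡ hp (ρ j) i
    mp zero zero _ = trans (cong σ (sym eo)) (σ-out j jk)
    mp zero (suc t) ee = ⊥-elim (1+n≢0 (trans ee (cong pred e)))
    mp (suc i) t ee = ⊥-elim (1+n≢0 (trans ee (cong pred e)))

  -- A longer hub path: out(j) is not an in-vertex, so σ (out j) = in(ρ j)
  -- has a unique out-neighbour and the path lemma applies.
  hub-long : ∀ j n' → j < K → h M j ≡ suc (suc n') → HubRes j
  hub-long j n' jk e = go (h M a) refl
    where
    a = ρ j
    ak = ρ<k j jk
    eo : vout j ≡ hp j (suc n')
    eo = cong (λ z → vtx (pos j H (pred z))) e
    jl : ∀ {i} → i < suc (suc n') → i < h M j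
    jl il = subst (λ w → _ < w) (sym e) il
    nin : ¬ IsIn (lab (vout j))
    nin ii = 1+n≢0 (proj₂ (subst IsIn (trans (cong lab eo) (lab-hp j (suc n') jk (jl ≤-refl))) ii))
    ha≢1 : h M a ≢ 1
    ha≢1 ea = UOut→¬Out (σ-UIn (shape-UIn (vout j) nin)) (subst (IsOut M) (sym (σ-out-lab j jk)) (refl , sym ea))
    parc : ∀ i → i < suc n' → A (hp j i) (hp j (suc i))
    parc i il = hub-arc j jk i (jl (s≤s il))
    q0 : hp a 0 ≡ σ (hp j (suc n'))
    q0 = sym (trans (cong σ (sym eo)) (σ-out j jk))
    ui : UIn (hp j (suc n')) (hp j n')
    ui = uin-arc (subst (λ z → UIn z (vtx (predPos M (lab z)))) eo (shape-UIn (vout j) nin)) (parc n' ≤-refl)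
    go : ∀ m → h M a ≡ m → HubRes j
    go zero ea = ⊥-elim (<-irrefl (sym ea) (h>0 wf a))
    go (suc zero) ea = ⊥-elim (ha≢1 ea)
    go (suc (suc m')) ea = trans ea (sym (trans e (cong suc (cong suc (suc-injective P.same-length))))) ,
                           λ i t ee → sym (P.reflected i t (trans ee (cong pred e)))
      where
      al : ∀ {i} → i < suc (suc m') → i < h M a
      al il = subst (λ w → _ < w) (sym ea) il
      qarc : ∀ i → i < suc m' → A (hp a i) (hp a (suc i))
      qarc i il = hub-arc a ak i (al (s≤s il))
      q1 : hp a 1 ≡ σ (hp j n')
      q1 = proj₂ (σ-UIn ui) (hp a 1) (subst (λ z → A z (hp a 1)) q0 (qarc 0 (s≤s z≤n)))
      module P = PathReflection (hp j) (hp a) n' m' parc (λ i 0i il → hub-int j jk i 0i (jl (s≤s il))) (hub-in j jk)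
                   qarc (λ i 0i il → hub-int a ak i 0i (al (s≤s il))) (hub-out a ak (suc m') (sym ea)) q0 q1

  hubLemma : ∀ j → j < K → HubRes j
  hubLemma j jk = go (h M j) refl
    where
    go : ∀ n → h M j ≡ n → HubRes j
    go zero e = ⊥-elim (<-irrefl (sym e) (h>0 wf j))
    go (suc zero) e = hub-short j jk e
    go (suc (suc n')) e = hub-long j n' jk e

  cOf : PK → ℕ → ℕ
  cOf PF a = a
  cOf PB a = prev K a

  cOf<k : ∀ X a → a < K → cOf X a < K
  cOf<k PF a ak = ak
  cOf<k PB a ak = prev<k a ak

  pstart-cOf : ∀ X a → a < K → pstart X (cOf X a) ≡ a
  pstart-cOf PF a ak = refl
  pstart-cOf PB a ak = next-prev a ak

  σ-in : ∀ j → j < K → σ (hp j 0) ≡ vout (ρ j)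
  σ-in j jk = trans (proj₂ (hubLemma j jk) (pred (h M j)) 0 (+-identityʳ _))
                    (cong (λ z → vtx (pos (ρ j) H (pred z))) (sym (proj₁ (hubLemma j jk))))

  FRes : ℕ → Set
  FRes j = Σ PK λ X → pend X (cOf X (ρ (next K j))) ≡ ρ j × plen X (cOf X (ρ (next K j))) ≡ f M j ×
             (∀ i t → i + t ≡ suc (f M j) → vp X (cOf X (ρ (next K j))) i ≡ σ (vp PF j t))

  fLemma : ∀ j → j < K → FRes j
  fLemma j jk = X , endeq , lenEq , λ i t e → P.reflected i t e
    where
    nj = next K j
    njk = next<k j 0<k
    a = ρ nj
    ak = ρ<k nj njk
    n' = f M j
    p = vp PF j
    pend-eq : p (suc n') ≡ hp nj 0
    pend-eq = vp-end' PF j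
    σpn : σ (p (suc n')) ≡ vout a
    σpn = trans (cong σ pend-eq) (σ-in nj njk)
    arc' : A (vout a) (σ (p n'))
    arc' = subst (λ z → A z (σ (p n'))) σpn (skew _ _ (vp-arc PF j jk n' ≤-refl))
    lab-σpn : lab (σ (p n')) ≡ succ M true (outP M a) ⊎ lab (σ (p n')) ≡ succ M false (outP M a)
    lab-σpn = subst (λ z → MArc M z (lab (σ (p n')))) (lab-vtx _ (outP-valid M wf a ak)) (A→ arc')
    choose : Σ PK λ X → lab (σ (p n')) ≡ succ M (pbool X) (outP M a)
    choose = [ (λ e → PF , e) , (λ e → PB , e) ]′ lab-σpn
    X = proj₁ choose
    c = cOf X a
    ck = cOf<k X a ak
    q = vp X c
    m' = plen X c
    q0 : q 0 ≡ σ (p (suc n'))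
    q0 = trans (cong vtx (trans (pp-0 X c) (cong (outP M) (pstart-cOf X a ak)))) (sym σpn)
    q1 : q 1 ≡ σ (p n')
    q1 = trans (cong vtx (trans (pp-second X c ck) (cong (λ z → succ M (pbool X) (outP M z)) (pstart-cOf X a ak))))
               (trans (cong vtx (sym (proj₂ choose))) (vtx-lab _))
    module P = PathReflection p q n' m' (vp-arc PF j jk) (vp-int PF j jk) (vp-0 PF j jk)
                   (vp-arc X c ck) (vp-int X c ck) (vp-end X c ck) q0 q1
    lenEq : plen X c ≡ f M j
    lenEq = sym (suc-injective P.same-length)
    endv : hp (pend X c) 0 ≡ hp (ρ j) 0
    endv = trans (sym (vp-end' X c)) (trans (P.reflected (suc m') 0 (trans (+-identityʳ _) (cong suc lenEq))) (σ-out j jk))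
    endeq : pend X c ≡ ρ j
    endeq = pos-injʲ (vtx-inj _ _ (inP-valid M wf _ (pend<k X c ck)) (inP-valid M wf _ (ρ<k j jk)) endv)

  inP-inj : ∀ i j → i < K → j < K → hp i 0 ≡ hp j 0 → i ≡ j
  inP-inj i j ik jk e = pos-injʲ (vtx-inj _ _ (inP-valid M wf i ik) (inP-valid M wf j jk) e)

  -- ρ is an involution of the hubs without fixed points; a fixed hub
  -- would have its hub path mapped onto itself reversed.
  ρ-inv : ∀ j → j < K → ρ (ρ j) ≡ j
  ρ-inv j jk = sym (inP-inj j (ρ (ρ j)) jk (ρ<k _ (ρ<k j jk))
      (trans (sym (involutive (hp j 0))) (trans (cong σ (σ-in j jk)) (σ-out (ρ j) (ρ<k j jk)))))

  ρ-inj : ∀ i j → i < K → j < K → ρ i ≡ ρ j → i ≡ j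
  ρ-inj i j ik jk e = trans (sym (ρ-inv i ik)) (trans (cong ρ e) (ρ-inv j jk))

  ρ-nofix : ∀ j → j < K → ρ j ≢ j
  ρ-nofix j jk e = no-reverse noFixed unit (hp j) (pred (h M j)) arcs rev
    where
    arcs : ∀ i → i < pred (h M j) → A (hp j i) (hp j (suc i))
    arcs i il = hub-arc j jk i (subst (suc (suc i) ≤_) (sucpred _ (h>0 wf j)) (s≤s il))
    rev : ∀ i j' → i + j' ≡ pred (h M j) → σ (hp j i) ≡ hp j j'
    rev i j' ee = subst (λ z → σ (hp j i) ≡ hp z j') e (proj₂ (hubLemma j jk) j' i (trans (+-comm j' i) ee))

  -- Hub j is of reflection type if σ maps its F-path onto an F-path, and
  -- of rotation type if onto a B-path.
  Refl Rot : ℕ → Set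
  Refl j = ρ j ≡ next K (ρ (next K j))
  Rot j = ρ j ≡ prev K (ρ (next K j))

  type : ∀ j → j < K → Refl j ⊎ Rot j
  type j jk = tp (fLemma j jk)
    where
    tp : FRes j → Refl j ⊎ Rot j
    tp (PF , e , _) = inj₁ (sym e)
    tp (PB , e , _) = inj₂ (sym e)

  -- Consecutive hubs have the same type, so all hubs have the type of 0.
  nnk : ∀ j → j < K → next K (next K j) < K
  nnk j jk = next<k _ 0<k

  reflRot : ∀ j → j < K → Refl j → Rot (next K j) → ⊥
  reflRot j jk r1 r2 = next²≢id j (k≥3 wf) (sym (ρ-inj j _ jk (nnk j jk)
      (trans r1 (trans (cong (next K) r2) (next-prev _ (ρ<k _ (nnk j jk)))))))

  rotRefl : ∀ j → j < K → Rot j → Refl (next K j) → ⊥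
  rotRefl j jk r1 r2 = next²≢id j (k≥3 wf) (sym (ρ-inj j _ jk (nnk j jk)
      (trans r1 (trans (cong (prev K) r2) (prev-next _ (ρ<k _ (nnk j jk)))))))

  reflRot' : ∀ j → j < K → Refl j → Rot j → ⊥
  reflRot' j jk r1 r2 = next≢prev M wf (ρ (next K j)) (ρ<k _ (next<k j 0<k)) (trans (sym r1) r2)

  allRefl : Refl 0 → ∀ j → j < K → Refl j
  allRefl r0 zero _ = r0
  allRefl r0 (suc j) sjk = tp (type (suc j) sjk)
    where
    jk = <-trans (n<1+n j) sjk
    tp : Refl (suc j) ⊎ Rot (suc j) → Refl (suc j)
    tp (inj₁ r) = r
    tp (inj₂ r) = ⊥-elim (reflRot j jk (allRefl r0 j jk) (subst Rot (sym (next-yes sjk)) r))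

  allRot : Rot 0 → ∀ j → j < K → Rot j
  allRot r0 zero _ = r0
  allRot r0 (suc j) sjk = tp (type (suc j) sjk)
    where
    jk = <-trans (n<1+n j) sjk
    tp : Refl (suc j) ⊎ Rot (suc j) → Rot (suc j)
    tp (inj₂ r) = r
    tp (inj₁ r) = ⊥-elim (rotRefl j jk (allRot r0 j jk) (subst Refl (sym (next-yes sjk)) r))

  refl-formula : (∀ j → j < K → Refl j) → ∀ j → j ≤ ρ 0 → ρ j ≡ ρ 0 ∸ j
  refl-formula rr zero _ = refl
  refl-formula rr (suc j) sjc = begin
    ρ (suc j)                  ≡⟨ cong ρ (sym (next-yes sjk)) ⟩
    ρ (next K j)               ≡⟨ sym (trans (cong (prev K) (rr j jk)) (prev-next _ (ρ<k _ (next<k j 0<k)))) ⟩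
    prev K (ρ j)               ≡⟨ cong (prev K) (refl-formula rr j (≤-trans (n≤1+n j) sjc)) ⟩
    prev K (ρ 0 ∸ j)           ≡⟨ cong (prev K) (∸-suc sjc) ⟩
    ρ 0 ∸ suc j                ∎
    where
    open ≡-Reasoning
    sjk : suc j < K
    sjk = ≤-<-trans sjc (ρ<k 0 0<k)
    jk = <-trans (n<1+n j) sjk
    ∸-suc : ∀ {c j} → suc j ≤ c → c ∸ j ≡ suc (c ∸ suc j)
    ∸-suc {suc c} {zero} _ = refl
    ∸-suc {suc c} {suc j} (s≤s le) = ∸-suc {c} {j} le

  -- Not every hub is of reflection type: then the hubs 0, …, ρ 0 would be
  -- reversed by ρ, and σ would map the middle hub path (if ρ 0 is even) or
  -- the middle forward path (if ρ 0 is odd) onto itself reversed.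
  noRefl : Refl 0 → ⊥
  noRefl r0 = parCase (parityN (ρ 0))
    where
    rr = allRefl r0
    ck : ρ 0 < K
    ck = ρ<k 0 0<k
    cf = refl-formula rr
    parCase : Σ ℕ (λ i → ρ 0 ≡ i + i) ⊎ Σ ℕ (λ i → ρ 0 ≡ suc (i + i)) → ⊥
    parCase (inj₁ (i , e)) = ρ-nofix i ik (trans (cf i ic) (trans (cong (_∸ i) e) (m+n∸n≡m i i)))
      where ic : i ≤ ρ 0
            ic = subst (i ≤_) (sym e) (m≤m+n i i)
            ik = ≤-<-trans ic ck
    parCase (inj₂ (i , e)) = fcase (fLemma i ik)
      where
      ic : suc i ≤ ρ 0
      ic = subst (suc i ≤_) (sym e) (s≤s (m≤m+n i i))
      ik = <-trans (n<1+n i) (≤-<-trans ic ck)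
      ρi : ρ i ≡ suc i
      ρi = trans (cf i (<⇒≤ ic)) (trans (cong (_∸ i) e) (m+n∸n≡m (suc i) i))
      ρni : ρ (next K i) ≡ i
      ρni = trans (cong ρ (trans (next-yes (≤-<-trans ic ck)) (sym ρi))) (ρ-inv i ik)
      fcase : FRes i → ⊥
      fcase (PB , e' , _) = reflRot' i ik (rr i ik) (sym e')
      fcase (PF , e' , _ , mp) = no-reverse noFixed unit (vp PF i) (suc (f M i)) (vp-arc PF i ik)
        (λ a b ab → sym (subst (λ z → vp PF z b ≡ σ (vp PF i a)) ρni (mp b a (trans (+-comm b a) ab))))

  rot0 : Rot 0
  rot0 = tp (type 0 0<k)
    where
    tp : Refl 0 ⊎ Rot 0 → Rot 0
    tp (inj₁ r) = ⊥-elim (noRefl r)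
    tp (inj₂ r) = r

  rotAll : ∀ j → j < K → Rot j
  rotAll = allRot rot0

  ρ-comm : ∀ j → j < K → ρ (next K j) ≡ next K (ρ j)
  ρ-comm j jk = sym (trans (cong (next K) (rotAll j jk)) (next-prev _ (ρ<k _ (next<k j 0<k))))

  c0 : ℕ
  c0 = ρ 0

  c0k : c0 < K
  c0k = ρ<k 0 0<k

  ρ-rot : ∀ j → j < K → ρ j ≡ rot K c0 j
  ρ-rot zero _ = sym (trans (rot-yes 0 (subst (_< K) (sym (+-identityʳ c0)) c0k)) (+-identityʳ c0))
  ρ-rot (suc j) sjk = begin
    ρ (suc j)              ≡⟨ cong ρ (sym (next-yes sjk)) ⟩
    ρ (next K j)           ≡⟨ ρ-comm j jk ⟩
    next K (ρ j)           ≡⟨ cong (next K) (ρ-rot j jk) ⟩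
    next K (rot K c0 j)    ≡⟨ rot-next j c0k sjk ⟩
    rot K c0 (suc j)       ∎
    where
    open ≡-Reasoning
    jk = <-trans (n<1+n j) sjk

  -- Since ρ is an involution without fixed points, c0 + c0 = K.
  half-turn : c0 + c0 ≡ K
  half-turn = go (c0 + c0 <? K)
    where
    rc : rot K c0 c0 ≡ 0
    rc = trans (sym (ρ-rot c0 c0k)) (ρ-inv 0 0<k)
    go : Dec (c0 + c0 < K) → c0 + c0 ≡ K
    go (yes p) = ⊥-elim (ρ-nofix 0 0<k (m+n≡0⇒m≡0 c0 (trans (sym (rot-yes c0 p)) rc)))
    go (no p) = ≤-antisym (m∸n≡0⇒m≤n (trans (sym (rot-no c0 p)) rc)) (≮⇒≥ p)

  H-formula : ∀ j t → j < K → t < h M j → σ (hp j t) ≡ hp (ρ j) (pred (h M j) ∸ t)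
  H-formula j t jk tl = proj₂ (hubLemma j jk) (pred (h M j) ∸ t) t (m∸n+n≡m (≤-pred (subst (suc t ≤_) (sym (sucpred _ (h>0 wf j))) tl)))

  -- Since all hubs are of rotation type, σ maps each forward path,
  -- reversed, onto a backward path of the same length.
  forward-to-backward : ∀ j → j < K → b M (prev K (ρ (next K j))) ≡ f M j ×
            (∀ i t → i + t ≡ suc (f M j) → vp PB (prev K (ρ (next K j))) i ≡ σ (vp PF j t))
  forward-to-backward j jk = tp (fLemma j jk)
    where
    tp : FRes j → b M (prev K (ρ (next K j))) ≡ f M j ×
            (∀ i t → i + t ≡ suc (f M j) → vp PB (prev K (ρ (next K j))) i ≡ σ (vp PF j t))
    tp (PF , e , _) = ⊥-elim (reflRot' j jk (sym e) (rotAll j jk))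
    tp (PB , e , l , mp) = l , mp

  F-formula : ∀ j t → j < K → t < f M j → σ (vtx (pos j F t)) ≡ vp PB (prev K (ρ (next K j))) (f M j ∸ t)
  F-formula j t jk tl = sym (trans (proj₂ (forward-to-backward j jk) (f M j ∸ t) (suc t) e) (cong σ (cong vtx (pp-in PF j t tl))))
    where e : f M j ∸ t + suc t ≡ suc (f M j)
          e = trans (+-suc _ t) (cong suc (m∸n+n≡m (<⇒≤ tl)))

  prev-ρ-next-ρ : ∀ j → j < K → prev K (ρ (next K (ρ j))) ≡ j
  prev-ρ-next-ρ j jk = trans (cong (prev K) (trans (ρ-comm (ρ j) (ρ<k j jk)) (cong (next K) (ρ-inv j jk)))) (prev-next j jk)

  B-formula : ∀ j t → j < K → t < b M j → vtx (pos j B t) ≡ σ (vp PF (ρ j) (f M (ρ j) ∸ t))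
  B-formula j t jk tl = trans (cong vtx (sym (pp-in PB j t tl)))
      (subst (λ z → vp PB z (suc t) ≡ σ (vp PF (ρ j) (f M (ρ j) ∸ t))) (prev-ρ-next-ρ j jk)
        (proj₂ (forward-to-backward j' j'k) (suc t) (f M j' ∸ t) e))
    where
    j' = ρ j
    j'k = ρ<k j jk
    bl : b M j ≡ f M j'
    bl = trans (cong (b M) (sym (prev-ρ-next-ρ j jk))) (proj₁ (forward-to-backward j' j'k))
    e : suc t + (f M j' ∸ t) ≡ suc (f M j')
    e = cong suc (m+[n∸m]≡n (<⇒≤ (subst (t <_) bl tl)))

  σ-B-formula : ∀ j t → j < K → t < b M j → σ (vtx (pos j B t)) ≡ vp PF (ρ j) (f M (ρ j) ∸ t)
  σ-B-formula j t jk tl = trans (cong σ (B-formula j t jk tl)) (involutive _)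

  σ-mirror : ∀ v → σ v ≡ mirror c0 (lab v)
  σ-mirror v = go (lab v) refl
    where
    go : ∀ p → lab v ≡ p → σ v ≡ mirror c0 p
    go (pos j s t) e = trans (cong σ (sym ev)) (at s (proj₁ vv) (proj₂ vv))
      where
      vv = subst (Valid M) e (lab-valid v)
      ev : vtx (pos j s t) ≡ v
      ev = trans (cong vtx (sym e)) (vtx-lab v)
      at : ∀ s' → j < K → t < len M s' j → σ (vtx (pos j s' t)) ≡ mirror c0 (pos j s' t)
      at H jk tl = trans (H-formula j t jk tl) (cong (λ z → hp z (pred (h M j) ∸ t)) (ρ-rot j jk))
      at F jk tl = trans (F-formula j t jk tl)
                         (cong (λ z → vp PB (prev K z) (f M j ∸ t)) (ρ-rot (next K j) (next<k j 0<k)))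
      at B jk tl = trans (σ-B-formula j t jk tl) (cong (λ z → vp PF z (f M z ∸ t)) (ρ-rot j jk))

-- Any two unit-free skew-symmetries of a realised digraph agree: both are
-- the mirror map of the half-turn rotation.
realised-uniqueness : (G : Digraph) → Realisation G →
    (σ τ : Fin (size G) → Fin (size G)) →
    UnitFreeSkewSymmetry G σ → UnitFreeSkewSymmetry G τ →
    ∀ v → σ v ≡ τ v
realised-uniqueness G (M , wf , L) σ τ (skσ , ufσ) (skτ , ufτ) v = begin
    σ v                   ≡⟨ Sσ.σ-mirror v ⟩
    mirror Sσ.c0 (lab v)  ≡⟨ cong (λ c → mirror c (lab v)) same-half ⟩
    mirror Sτ.c0 (lab v)  ≡⟨ sym (Sτ.σ-mirror v) ⟩
    τ v                   ∎
  where
  open ≡-Reasoning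
  open SegmentPaths G M wf L
  module Sσ = Symmetry G M wf L σ skσ ufσ
  module Sτ = Symmetry G M wf L τ skτ ufτ
  same-half : Sσ.c0 ≡ Sτ.c0
  same-half = double-inj _ _ (trans Sσ.half-turn (sym Sτ.half-turn))

theorem7p7 : (G : Digraph) → WDC G →
    (σ τ : Fin (size G) → Fin (size G)) →
    UnitFreeSkewSymmetry G σ → UnitFreeSkewSymmetry G τ →
    ∀ v → σ v ≡ τ v
theorem7p7 G w = realised-uniqueness G (realise-wdc G w)
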